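{- Let $D_S=(N_S,A_S\cup H_S)$ be a partially time-expanded network with arc capacities $u'$ and holdover storage capacities $b'$ satisfying properties (P1)–(P4), $(P^{\mathtt{arcs}})$ and $(P^{\mathtt{storage}})$. Then the optimal value of $\mathrm{UPR}(D_S)$ is at most the optimal value of $\mathrm{UPR}(D_T)$.
   Context: Base network: a directed graph $D=(N,A)$; each arc $vw\in A$ has a transit time $\tau_{vw}\in\mathbb{N}$ and a capacity $u_{vw}\in\mathbb{N}$; each node $v\in N$ has a storage capacity $b_v\in\mathbb{N}$. $\mathcal{K}$ is a finite set of packets; packet $k$ has origin $s_k$ and destination $t_k$. For $v\in N$ let $\mathcal{K}_v=\{k\in\mathcal{K}: s_k\ne v,\ t_k\ne v\}$. Fix $T\in\mathbb{N}$, $[T]=\{0,\dots,T\}$. Fully time-expanded network $D_T=(N_T,A_T\cup H_T)$: $N_T=\{(v,t):v\in N,t\in[T]\}$; movement arcs $A_T=\{((v,t),(w,t+\tau_{vw})): (v,t)\in N_T, vw\in A, t+\tau_{vw}\le T\}$; holdover arcs $H_T=\{((v,t),(v,t+1)): v\in N, 0\le t<T\}$. $\mathrm{UPR}(D_T)$ is the integer program with binary variables $x^k_e$ ($k\in\mathcal{K}$, $e\in A_T\cup H_T$) and variable $\bar T$: minimize $\bar T$ s.t. $t'x^k_e\le\bar T$ for all $k$, $e=((v,t),(w,t'))\in A_T$; $\sum_{e=((v,t),(w,t'))\in A_T,\,w=t_k}t'x^k_e\le\bar T$ for all $k$; flow conservation for each $k$ at each $(v,t)\in N_T$ (out-flow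 minus in-flow equals $1$ at $(s_k,0)$, $-1$ at $(t_k,T)$, $0$ otherwise); $\sum_k x^k_e\le u_{vw}$ for each copy $e\in A_T$ of $vw$; $\sum_{k\in\mathcal{K}_v}x^k_e\le b_v$ for each holdover arc $e$ at $v$. Partially time-expanded network: $N_S\subseteq N_T$; $\mathtt{n_S}(v,t)=\min\{t'>t:(v,t')\in N_S\}$, $\mathtt{m_S}(v,t)=\mathtt{n_S}(v,t)-t$ (defined even if $(v,t)\notin N_S$); $H_S$ consists of the arcs $((v,t),(v,\mathtt{n_S}(v,t)))$ for $(v,t)\in N_S$, $t<T$; $A_S$ is a set of arcs $((v,t),(w,t'))$ with both ends in $N_S$ and $vw\in A$. Properties: (P1) $(s_k,0),(t_k,T)\in N_S$ for all $k$; (P2) each $((v,t),(w,t'))\in A_S$ has $t'\le t+\tau_{vw}$; (P3) for each $vw\in A$ and $(v,t)\in N_S$ with $t+\tau_{vw}\le T$, $A_S$ contains a copy of $vw$ starting at $(v,t)$; (P4) if $((v,t),(w,t'))\in A_S$ there is no $(w,t'')\in N_S$ with $t'<t''\le t+\tau_{vw}$. $(P^{\mathtt{arcs}})$: every $e=((v,t),(w,t'))\in A_S$ has capacity $u'_e=u_{vw}\,\mathtt{m_S}(v,t)$. Let $N^-_S(v,t)=\{(w,t'):((w,t'),(v,t))\in A_S\}$, $N^-_T(v,t)=\{(w,t'):((w,t'),(v,t))\in A_T\}$, and for $e=((v,t),(v,t'))\in H_S$ let $U_e=\sum_{(w,t')\in N^-_T(v,t)\cup N^-_S(v,t)}u_{wv}(\mathtt{m_S}(w,t')-1)$.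 $(P^{\mathtt{storage}})$: every $e=((v,t),(v,t'))\in H_S$ has $b'_e\ge b_v+U_e$ if $(v,t+1)\in N_S$ and $b'_e\ge 2b_v+U_e$ if $(v,t+1)\notin N_S$. $\mathrm{UPR}(D_S)$ is the integer program with binary variables $x^k_e$ ($k\in\mathcal{K}$, $e\in A_S\cup H_S$) and variable $\bar T$: minimize $\bar T$ s.t. $(t+\tau_{vw})x^k_e\le\bar T$ for all $k$ and $e=((v,t),(w,t'))\in A_S$; $\sum_{e=((v,t),(w,t'))\in A_S,\,w=t_k}(t+\tau_{vw})x^k_e\le\bar T$ for all $k$; flow conservation for each $k$ at each $(v,t)\in N_S$ in $D_S$ (out minus in equals $1$ at $(s_k,0)$, $-1$ at $(t_k,T)$, $0$ otherwise); $\sum_k x^k_e\le u'_e$ for $e\in A_S$; $\sum_{k\in\mathcal{K}_v}x^k_e\le b'_e$ for each $e\in H_S$ at $v$. -}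

module Defs where

open import Data.Nat using (ℕ; zero; suc; _+_; _*_; _∸_; _≤_; _<_; _≡ᵇ_; _≤ᵇ_; _<ᵇ_)
open import Data.Bool using (Bool; true; false; if_then_else_; _∧_; _∨_; not)
open import Data.Fin using (Fin; _≟_)
open import Data.List using (List; map; upTo; allFin)
open import Data.Nat.ListAction using (sum)
open import Data.Product using (_×_; ∃)
open import Relation.Nullary using (¬_; does)
open import Relation.Binary.PropositionalEquality using (_≡_)

bit : Bool → ℕ
bit true  = 1
bit false = 0

[_]·_ : Bool → ℕ → ℕ
[ c ]· x = if c then x else 0

ΣFin : (m : ℕ) → (Fin m → ℕ) → ℕ
ΣFin m f = sum (map f (allFin m))

Σ≤ : ℕ → (ℕ → ℕ) → ℕ
Σ≤ T f = sum (map f (upTo (suc T)))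

firstFrom : (ℕ → Bool) → ℕ → ℕ → ℕ → ℕ
firstFrom p start zero      d = d
firstFrom p start (suc cnt) d =
  if p start then start else firstFrom p (suc start) cnt d

record Instance : Set where
  field
    n   : ℕ
    arc : Fin n → Fin n → Bool
    τ   : Fin n → Fin n → ℕ
    u   : Fin n → Fin n → ℕ
    b   : Fin n → ℕ
    K   : ℕ
    src : Fin K → Fin n
    dst : Fin K → Fin n
    T   : ℕ

module _ (I : Instance) where
  open Instance I

  inKv : Fin n → Fin K → Bool
  inKv v k = not (does (src k ≟ v)) ∧ not (does (dst k ≟ v))

  -- UPR(D_T).  Movement arc ((v,t),(w,t+τ_vw)) is indexed by (v,w,t) with
  -- arc v w and t + τ_vw ≤ T; holdover arc ((v,t),(v,t+1)) by (v,t), t < T.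

  MoveVarsT : Set
  MoveVarsT = Fin K → Fin n → Fin n → ℕ → Bool

  HoldVarsT : Set
  HoldVarsT = Fin K → Fin n → ℕ → Bool

  isMoveT : Fin n → Fin n → ℕ → Bool
  isMoveT v w t = arc v w ∧ (t + τ v w ≤ᵇ T)

  outT : MoveVarsT → HoldVarsT → Fin K → Fin n → ℕ → ℕ
  outT x h k v t =
    ΣFin n (λ w → [ isMoveT v w t ]· bit (x k v w t))
    + [ t <ᵇ T ]· bit (h k v t)

  inT : MoveVarsT → HoldVarsT → Fin K → Fin n → ℕ → ℕ
  inT x h k v t =
    ΣFin n (λ w → Σ≤ T (λ t' → [ arc w v ∧ (t' + τ w v ≡ᵇ t) ]· bit (x k w v t')))
    + [ 0 <ᵇ t ]· bit (h k v (t ∸ 1))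

  supply : Fin K → Fin n → ℕ → ℕ
  supply k v t = [ does (v ≟ src k) ∧ (t ≡ᵇ 0) ]· 1

  demand : Fin K → Fin n → ℕ → ℕ
  demand k v t = [ does (v ≟ dst k) ∧ (t ≡ᵇ T) ]· 1

  record FeasibleT (x : MoveVarsT) (h : HoldVarsT) (Tbar : ℕ) : Set where
    field
      arrival : ∀ k v w t → arc v w ≡ true → t + τ v w ≤ T →
                (t + τ v w) * bit (x k v w t) ≤ Tbar
      arrivalSum : ∀ k →
                ΣFin n (λ w → Σ≤ T (λ t →
                  [ isMoveT w (dst k) t ]· ((t + τ w (dst k)) * bit (x k w (dst k) t))))
                ≤ Tbar
      -- out − in = supply − demand, written additively in ℕ
      conservation : ∀ k v t → t ≤ T →
                outT x h k v t + demand k v t ≡ inT x h k v t + supply k v t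
      capacity : ∀ v w t → arc v w ≡ true → t + τ v w ≤ T →
                ΣFin K (λ k → bit (x k v w t)) ≤ u v w
      storage : ∀ v t → t < T →
                ΣFin K (λ k → [ inKv v k ]· bit (h k v t)) ≤ b v

  record PTEN : Set where
    field
      inS  : Fin n → ℕ → Bool
      inAS : Fin n → ℕ → Fin n → ℕ → Bool
      u'   : Fin n → ℕ → Fin n → ℕ → ℕ
      b'   : Fin n → ℕ → ℕ                   -- b'_e for e = ((v,t),(v,n_S(v,t))) ∈ H_S

  module _ (S : PTEN) where
    open PTEN S

    -- n_S(v,t) = min{t' > t : (v,t') ∈ N_S}; convention: T+1 if no such t'
    nS : Fin n → ℕ → ℕ
    nS v t = firstFrom (inS v) (suc t) (T ∸ t) (suc T)

    mS : Fin n → ℕ → ℕ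
    mS v t = nS v t ∸ t

    isHold : Fin n → ℕ → Bool
    isHold v t = inS v t ∧ (t <ᵇ T) ∧ (nS v t ≤ᵇ T)

    -- U_e for the holdover arc e leaving (v,t):  sum over the union
    -- N^-_T(v,t) ∪ N^-_S(v,t) (each pair (w,t') counted once)
    U : Fin n → ℕ → ℕ
    U v t = ΣFin n (λ w → Σ≤ T (λ t' →
              [ (arc w v ∧ (t' + τ w v ≡ᵇ t)) ∨ inAS w t' v t ]·
                (u w v * (mS w t' ∸ 1))))

    record Valid : Set where
      field
        NS⊆NT  : ∀ v t → inS v t ≡ true → t ≤ T
        AS-ends : ∀ v t w t' → inAS v t w t' ≡ true →
                  (inS v t ≡ true) × (inS w t' ≡ true) × (arc v w ≡ true)
        P1-src : ∀ k → inS (src k) 0 ≡ true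
        P1-dst : ∀ k → inS (dst k) T ≡ true
        P2     : ∀ v t w t' → inAS v t w t' ≡ true → t' ≤ t + τ v w
        P3     : ∀ v w t → arc v w ≡ true → inS v t ≡ true → t + τ v w ≤ T →
                 ∃ λ t' → inAS v t w t' ≡ true
        P4     : ∀ v t w t' → inAS v t w t' ≡ true →
                 ¬ (∃ λ t'' → (inS w t'' ≡ true) × (t' < t'') × (t'' ≤ t + τ v w))
        Parcs  : ∀ v t w t' → inAS v t w t' ≡ true →
                 u' v t w t' ≡ u v w * mS v t
        Pstorage-next : ∀ v t → isHold v t ≡ true → inS v (suc t) ≡ true →
                 b v + U v t ≤ b' v t
        Pstorage-gap  : ∀ v t → isHold v t ≡ true → inS v (suc t) ≡ false →
                 2 * b v + U v t ≤ b' v t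

    -- UPR(D_S).  Arc e = ((v,t),(w,t')) ∈ A_S indexed by (v,t,w,t');
    -- holdover arc ((v,t),(v,n_S(v,t))) ∈ H_S indexed by (v,t).

    MoveVarsS : Set
    MoveVarsS = Fin K → Fin n → ℕ → Fin n → ℕ → Bool

    HoldVarsS : Set
    HoldVarsS = Fin K → Fin n → ℕ → Bool

    outS : MoveVarsS → HoldVarsS → Fin K → Fin n → ℕ → ℕ
    outS y g k v t =
      ΣFin n (λ w → Σ≤ T (λ t' → [ inAS v t w t' ]· bit (y k v t w t')))
      + [ isHold v t ]· bit (g k v t)

    inS' : MoveVarsS → HoldVarsS → Fin K → Fin n → ℕ → ℕ
    inS' y g k v t =
      ΣFin n (λ w → Σ≤ T (λ t' → [ inAS w t' v t ]· bit (y k w t' v t)))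
      + Σ≤ T (λ t'' → [ isHold v t'' ∧ (nS v t'' ≡ᵇ t) ]· bit (g k v t''))

    record FeasibleS (y : MoveVarsS) (g : HoldVarsS) (Tbar : ℕ) : Set where
      field
        arrival : ∀ k v t w t' → inAS v t w t' ≡ true →
                  (t + τ v w) * bit (y k v t w t') ≤ Tbar
        arrivalSum : ∀ k →
                  ΣFin n (λ v → Σ≤ T (λ t → Σ≤ T (λ t' →
                    [ inAS v t (dst k) t' ]· ((t + τ v (dst k)) * bit (y k v t (dst k) t')))))
                  ≤ Tbar
        conservation : ∀ k v t → inS v t ≡ true →
                  outS y g k v t + demand k v t ≡ inS' y g k v t + supply k v t
        capacity : ∀ v t w t' → inAS v t w t' ≡ true →
                  ΣFin K (λ k → bit (y k v t w t')) ≤ u' v t w t'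
        storage : ∀ v t → isHold v t ≡ true →
                  ΣFin K (λ k → [ inKv v k ]· bit (g k v t)) ≤ b' v t

module Submission where

open import Defs
open import Data.Nat using (ℕ; zero; suc; _+_; _*_; _∸_; _≤_; _<_; z≤n; s≤s; s≤s⁻¹; z<s; _≡ᵇ_; _≤ᵇ_; _<ᵇ_; _≤?_; _<?_)
  renaming (_≟_ to _≟ℕ_)
open import Data.Nat.Properties hiding (_≟_)
open import Data.Nat.ListAction using (sum)
open import Data.Nat.Tactic.RingSolver using (solve-∀)
open import Algebra.Properties.CommutativeSemigroup +-commutativeSemigroup using () renaming (interchange to +-interchange)
open import Data.Bool using (Bool; true; false; if_then_else_; _∧_; _∨_; not)
open import Data.Bool.Properties using (∧-zeroʳ; ∨-zeroʳ)
open import Data.Empty using (⊥; ⊥-elim)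
open import Data.Fin using (Fin; _≟_)
open import Data.List using (List; []; _∷_; map; upTo; allFin)
open import Data.List.Properties using (map-applyUpTo; map-upTo)
open import Data.List.Membership.Propositional using (_∈_)
open import Data.List.Membership.Propositional.Properties using (∈-allFin; ∈-upTo⁺)
open import Data.List.Relation.Unary.Any using (here; there)
open import Data.List.Relation.Unary.All as All using (All; []; _∷_; lookup)
open import Data.List.Relation.Unary.Unique.Propositional using (Unique; []; _∷_)
open import Data.List.Relation.Unary.Unique.Propositional.Properties using (allFin⁺; upTo⁺)
open import Data.Product using (Σ; ∃; _×_; _,_; proj₁; proj₂)
open import Data.Sum using (_⊎_; inj₁; inj₂)
open import Data.Unit using (⊤; tt)
open import Function using (_∘_; _∘′_; id)
open import Relation.Binary.Definitions using (tri<; tri≈; tri>)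
open import Relation.Binary.PropositionalEquality
open import Relation.Nullary using (¬_; Dec; yes; no; does; contradiction)
open import Relation.Nullary.Decidable using (dec-true; dec-false; _×-dec_; toSum)

-- A feasible solution of UPR(D_T) is turned, packet by packet, into one of UPR(D_S) with the
-- same T̄. By flow conservation the arcs used by packet k contain a walk from (s_k, 0) to
-- (t_k, T) in D_T. This walk is followed in D_S: a move along vw departing at time t is replaced
-- by the copy of vw leaving the last node (v, f) of N_S with f ≤ t, which exists by (P3) and
-- arrives no later by (P2), and waiting is replaced by holdover arcs; removing cycles gives a
-- 0/1 flow. A D_S arc leaving (v, f) is used only by packets whose D_T move departs in
-- [f, n_S(v, f)), hence by at most u_vw m_S(v, f) of them. A packet on the holdover arc at (v, c)
-- is held at v at time c or n_S(v, c) − 1 in D_T, or is on a D_T move towards v departing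
-- strictly inside the window of a node (w, t') with an arc into (v, c); the last kind is what
-- U_e counts, so (P^storage) bounds the load of the holdover arc.

∑ : ∀ {A : Set} → List A → (A → ℕ) → ℕ
∑ xs f = sum (map f xs)

module _ {A : Set} where

  ∑-cong : ∀ xs {f g : A → ℕ} → (∀ x → f x ≡ g x) → ∑ xs f ≡ ∑ xs g
  ∑-cong []       f≗g = refl
  ∑-cong (x ∷ xs) f≗g = cong₂ _+_ (f≗g x) (∑-cong xs f≗g)

  ∑-mono : ∀ xs {f g : A → ℕ} → (∀ x → f x ≤ g x) → ∑ xs f ≤ ∑ xs g
  ∑-mono []       f≤g = z≤n
  ∑-mono (x ∷ xs) f≤g = +-mono-≤ (f≤g x) (∑-mono xs f≤g)

  ∑-+ : ∀ xs (f g : A → ℕ) → ∑ xs (λ x → f x + g x) ≡ ∑ xs f + ∑ xs g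
  ∑-+ []       f g = refl
  ∑-+ (x ∷ xs) f g = trans (cong (f x + g x +_) (∑-+ xs f g)) (+-interchange (f x) (g x) _ _)

  ∑-*ˡ : ∀ xs c (f : A → ℕ) → ∑ xs (λ x → c * f x) ≡ c * ∑ xs f
  ∑-*ˡ []       c f = sym (*-zeroʳ c)
  ∑-*ˡ (x ∷ xs) c f = trans (cong (c * f x +_) (∑-*ˡ xs c f)) (sym (*-distribˡ-+ c (f x) _))

  ∑-zero : ∀ xs {f : A → ℕ} → (∀ x → f x ≡ 0) → ∑ xs f ≡ 0
  ∑-zero []       f≡0 = refl
  ∑-zero (x ∷ xs) f≡0 = cong₂ _+_ (f≡0 x) (∑-zero xs f≡0)

  term≤∑ : ∀ {xs} (f : A → ℕ) {x} → x ∈ xs → f x ≤ ∑ xs f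
  term≤∑ f (here refl) = m≤m+n _ _
  term≤∑ f (there x∈) = ≤-trans (term≤∑ f x∈) (m≤n+m _ _)

  ∑-pos : ∀ xs (f : A → ℕ) → 0 < ∑ xs f → ∃ λ x → x ∈ xs × 0 < f x
  ∑-pos (x ∷ xs) f pos with f x in fx
  ... | suc _ = x , here refl , subst (0 <_) (sym fx) z<s
  ... | zero with ∑-pos xs f pos
  ... | y , y∈ , fy = y , there y∈ , fy

  ∑-mono-< : ∀ {xs} {f g : A → ℕ} {x} → x ∈ xs → (∀ y → f y ≤ g y) → f x < g x → ∑ xs f < ∑ xs g
  ∑-mono-< {_ ∷ xs} (here refl) f≤g fx<gx = +-mono-<-≤ fx<gx (∑-mono xs f≤g)
  ∑-mono-< (there x∈) f≤g fx<gx = +-mono-≤-< (f≤g _) (∑-mono-< x∈ f≤g fx<gx)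

  private
    ∑-zero-all : ∀ {xs} (f : A → ℕ) → All (λ x → f x ≡ 0) xs → ∑ xs f ≡ 0
    ∑-zero-all f []         = refl
    ∑-zero-all f (fx ∷ fxs) = cong₂ _+_ fx (∑-zero-all f fxs)

  ∑-single : ∀ {xs} (f : A → ℕ) {x₀} → Unique xs → x₀ ∈ xs → (∀ x → x ≢ x₀ → f x ≡ 0) → ∑ xs f ≡ f x₀
  ∑-single {x ∷ xs} f (x∉ ∷ _) (here refl) off = trans (cong (f x +_) (∑-zero-all f (All.map (λ x≢y → off _ (x≢y ∘ sym)) x∉))) (+-identityʳ _)
  ∑-single {x ∷ xs} f (x∉ ∷ u) (there x₀∈) off = trans (cong (_+ ∑ xs f) (off x (lookup x∉ x₀∈))) (∑-single f u x₀∈ off)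

  ∑-atMostOne : ∀ {xs} (f : A → ℕ) c → Unique xs → (∀ x → f x ≤ c) → (∀ x y → 0 < f x → 0 < f y → x ≡ y) → ∑ xs f ≤ c
  ∑-atMostOne {[]}     f c u f≤c one = z≤n
  ∑-atMostOne {x ∷ xs} f c (x∉ ∷ u) f≤c one with f x in fx
  ... | zero  = ∑-atMostOne f c u f≤c one
  ... | suc m = subst (_≤ c) (sym (trans (cong (suc m +_) rest) (trans (+-identityʳ _) (sym fx)))) (f≤c x)
    where
    rest : ∑ xs f ≡ 0
    rest = ∑-zero-all f (All.map vanish x∉)
      where
      vanish : ∀ {y} → x ≢ y → f y ≡ 0
      vanish {y} x≢y with f y in fy
      ... | zero = refl
      ... | suc _ = contradiction (one x y (subst (0 <_) (sym fx) z<s) (subst (0 <_) (sym fy) z<s)) x≢y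

∑-comm : ∀ {A B : Set} xs ys (f : A → B → ℕ) → ∑ xs (λ x → ∑ ys (f x)) ≡ ∑ ys (λ y → ∑ xs (λ x → f x y))
∑-comm []       ys f = sym (∑-zero ys (λ _ → refl))
∑-comm (x ∷ xs) ys f = trans (cong (∑ ys (f x) +_) (∑-comm xs ys f)) (sym (∑-+ ys (f x) _))

∑-upTo-suc : ∀ m (g : ℕ → ℕ) → ∑ (upTo (suc m)) g ≡ g 0 + ∑ (upTo m) (g ∘ suc)
∑-upTo-suc m g = cong (λ l → g 0 + sum l) (trans (map-applyUpTo suc g m) (sym (map-upTo (g ∘ suc) m)))

∑-interval : ∀ m (g : ℕ → ℕ) c lo hi → (∀ t → g t ≤ c) → (∀ t → 0 < g t → lo ≤ t × t < hi) → ∑ (upTo m) g ≤ c * (hi ∸ lo)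
∑-interval zero g c lo hi g≤c supp = z≤n
∑-interval (suc m) g c lo zero g≤c supp = ≤-trans (≤-reflexive (∑-zero (upTo (suc m)) vanish)) z≤n
  where
  vanish : ∀ t → g t ≡ 0
  vanish t with g t in gt
  ... | zero = refl
  ... | suc _ with () ← proj₂ (supp t (subst (0 <_) (sym gt) z<s))
∑-interval (suc m) g c zero (suc hi) g≤c supp = begin
  ∑ (upTo (suc m)) g             ≡⟨ ∑-upTo-suc m g ⟩
  g 0 + ∑ (upTo m) (g ∘ suc)     ≤⟨ +-mono-≤ (g≤c 0) (∑-interval m (g ∘ suc) c zero hi (g≤c ∘ suc) shifted) ⟩
  c + c * hi                     ≡⟨ sym (*-suc c hi) ⟩
  c * suc hi                     ∎
  where
  open ≤-Reasoning
  shifted : ∀ t → 0 < g (suc t) → 0 ≤ t × t < hi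
  shifted t p = z≤n , s≤s⁻¹ (proj₂ (supp (suc t) p))
∑-interval (suc m) g c (suc lo) (suc hi) g≤c supp = begin
  ∑ (upTo (suc m)) g             ≡⟨ ∑-upTo-suc m g ⟩
  g 0 + ∑ (upTo m) (g ∘ suc)     ≡⟨ cong (_+ ∑ (upTo m) (g ∘ suc)) g0≡0 ⟩
  ∑ (upTo m) (g ∘ suc)           ≤⟨ ∑-interval m (g ∘ suc) c lo hi (g≤c ∘ suc) shifted ⟩
  c * (hi ∸ lo)                  ∎
  where
  open ≤-Reasoning
  g0≡0 : g 0 ≡ 0
  g0≡0 with g 0 in g0
  ... | zero = refl
  ... | suc _ with () ← proj₁ (supp 0 (subst (0 <_) (sym g0) z<s))
  shifted : ∀ t → 0 < g (suc t) → lo ≤ t × t < hi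
  shifted t p = s≤s⁻¹ (proj₁ (supp (suc t) p)) , s≤s⁻¹ (proj₂ (supp (suc t) p))

from-does : ∀ {A : Set} (a? : Dec A) → does a? ≡ true → A
from-does (yes a) _ = a

∧-true : ∀ {a b} → (a ∧ b) ≡ true → a ≡ true × b ≡ true
∧-true {true} {true} _ = refl , refl

∨-trueˡ : ∀ {a} b → a ≡ true → (a ∨ b) ≡ true
∨-trueˡ b refl = refl

∨-trueʳ : ∀ a {b} → b ≡ true → (a ∨ b) ≡ true
∨-trueʳ true  _    = refl
∨-trueʳ false refl = refl

∨-true : ∀ a {b} → (a ∨ b) ≡ true → a ≡ true ⊎ b ≡ true
∨-true true  _ = inj₁ refl
∨-true false e = inj₂ e

∨-resolveˡ : ∀ {a b} → a ≡ false → (a ∨ b) ≡ true → b ≡ true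
∨-resolveˡ refl e = e

∧-falseʳ : ∀ a {b} → b ≡ false → (a ∧ b) ≡ false
∧-falseʳ a refl = ∧-zeroʳ a

clash : ∀ {a} → a ≡ true → a ≡ false → ⊥
clash refl ()

false-if-not-true : ∀ {a} → (a ≡ true → ⊥) → a ≡ false
false-if-not-true {false} _ = refl
false-if-not-true {true}  f with () ← f refl

≡ᵇ-comm : ∀ m n → (m ≡ᵇ n) ≡ (n ≡ᵇ m)
≡ᵇ-comm m n with toSum (m ≟ℕ n)
... | inj₁ refl = refl
... | inj₂ m≢n  = trans (dec-false (m ≟ℕ n) m≢n) (sym (dec-false (n ≟ℕ m) (m≢n ∘ sym)))

bit≤1 : ∀ a → bit a ≤ 1
bit≤1 true  = ≤-refl
bit≤1 false = z≤n

bit-∨ : ∀ a b → (a ≡ true → b ≡ false) → bit (a ∨ b) ≡ bit a + bit b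
bit-∨ true  b disj rewrite disj refl = refl
bit-∨ false b disj = refl

bit-drop : ∀ a {u} → (u ≡ true → a ≡ true) → bit a ≡ bit (a ∧ not u) + bit u
bit-drop true  {true}  _  = refl
bit-drop true  {false} _  = refl
bit-drop false {false} _  = refl
bit-drop false {true}  au with () ← au refl

[]·1≡bit : ∀ c → [ c ]· 1 ≡ bit c
[]·1≡bit true  = refl
[]·1≡bit false = refl

[]·-zero : ∀ c → [ c ]· 0 ≡ 0
[]·-zero true  = refl
[]·-zero false = refl

[]·-false : ∀ {c} x → c ≡ false → [ c ]· x ≡ 0
[]·-false x refl = refl

[]·bit-false : ∀ c {a} → a ≡ false → [ c ]· bit a ≡ 0
[]·bit-false c refl = []·-zero c

[]·-≤ : ∀ c x → [ c ]· x ≤ x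
[]·-≤ true  x = ≤-refl
[]·-≤ false x = z≤n

[]·-≤-from : ∀ c {m n} → (c ≡ true → m ≤ n) → [ c ]· m ≤ n
[]·-≤-from true  m≤n = m≤n refl
[]·-≤-from false _   = z≤n

[]·-mono : ∀ c {x y} → x ≤ y → [ c ]· x ≤ [ c ]· y
[]·-mono true  x≤y = x≤y
[]·-mono false x≤y = z≤n

[]·-+ : ∀ c x y → [ c ]· (x + y) ≡ [ c ]· x + [ c ]· y
[]·-+ true  x y = refl
[]·-+ false x y = refl

[]·-* : ∀ c m x → [ c ]· (m * x) ≡ m * [ c ]· x
[]·-* true  m x = refl
[]·-* false m x = sym (*-zeroʳ m)

[]·-pos : ∀ c x → 0 < [ c ]· x → c ≡ true
[]·-pos true x _ = refl

[]·bit-pos : ∀ c a → 0 < [ c ]· bit a → c ≡ true × a ≡ true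
[]·bit-pos true true _ = refl , refl

∑-[]· : ∀ {A : Set} (xs : List A) c (f : A → ℕ) → ∑ xs (λ x → [ c ]· f x) ≡ [ c ]· ∑ xs f
∑-[]· xs true  f = refl
∑-[]· xs false f = ∑-zero xs (λ _ → refl)

∑[]·bit-∨ : ∀ {A : Set} xs (g a b : A → Bool) → (∀ x → a x ≡ true → b x ≡ false) →
            ∑ xs (λ x → [ g x ]· bit (a x ∨ b x)) ≡ ∑ xs (λ x → [ g x ]· bit (a x)) + ∑ xs (λ x → [ g x ]· bit (b x))
∑[]·bit-∨ xs g a b disj =
  trans (∑-cong xs (λ x → trans (cong ([ g x ]·_) (bit-∨ (a x) (b x) (disj x))) ([]·-+ (g x) _ _))) (∑-+ xs _ _)

-- The next and the previous element of a set of times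

data FirstFrom (p : ℕ → Bool) (st cnt d : ℕ) : ℕ → Set where
  none  : (∀ j → st ≤ j → j < st + cnt → p j ≡ false) → FirstFrom p st cnt d d
  found : ∀ {f} → st ≤ f → f < st + cnt → p f ≡ true → (∀ j → st ≤ j → j < f → p j ≡ false) →
          FirstFrom p st cnt d f

firstFrom-view : ∀ p st cnt d → FirstFrom p st cnt d (firstFrom p st cnt d)
firstFrom-view p st zero      d = none (λ j st≤j j<st+0 → contradiction (≤-trans (≤-reflexive (+-identityʳ st)) st≤j) (<⇒≱ j<st+0))
firstFrom-view p st (suc cnt) d with p st in pst
... | true  = found ≤-refl (m<m+n st z<s) pst (λ j st≤j j<st → contradiction st≤j (<⇒≱ j<st))
... | false with firstFrom p (suc st) cnt d | firstFrom-view p (suc st) cnt d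
...   | _ | none gap = none (λ j st≤j j<end → extend j st≤j (subst (j <_) (+-suc st cnt) j<end) gap)
  where
  extend : ∀ {e} j → st ≤ j → j < suc st + e → (∀ j → suc st ≤ j → j < suc st + e → p j ≡ false) → p j ≡ false
  extend j st≤j j<e gap with m≤n⇒m<n∨m≡n st≤j
  ... | inj₁ st<j = gap j st<j j<e
  ... | inj₂ refl = pst
...   | f | found st<f f<end pf gap =
  found (≤-trans (n≤1+n st) st<f) (subst (f <_) (sym (+-suc st cnt)) f<end) pf extend
  where
  extend : ∀ j → st ≤ j → j < f → p j ≡ false
  extend j st≤j j<f with m≤n⇒m<n∨m≡n st≤j
  ... | inj₁ st<j = gap j st<j j<f
  ... | inj₂ refl = pst

module Next (T : ℕ) (p : ℕ → Bool) where

  next : ℕ → ℕ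
  next t = firstFrom p (suc t) (T ∸ t) (suc T)

  private
    window : ∀ {t} → t ≤ T → suc t + (T ∸ t) ≡ suc T
    window t≤T = cong suc (m+[n∸m]≡n t≤T)

  <next : ∀ {t} → t ≤ T → t < next t
  <next {t} t≤T with next t | firstFrom-view p (suc t) (T ∸ t) (suc T)
  ... | _ | none _            = s≤s t≤T
  ... | _ | found t<f _ _ _   = t<f

  gap-before-next : ∀ {t j} → t ≤ T → t < j → j < next t → p j ≡ false
  gap-before-next {t} {j} t≤T t<j j<f with next t | firstFrom-view p (suc t) (T ∸ t) (suc T)
  ... | _ | none gap          = gap j t<j (subst (j <_) (sym (window t≤T)) j<f)
  ... | _ | found _ _ _ gap   = gap j t<j j<f

  p-next : ∀ {t} → t ≤ T → next t ≤ T → p (next t) ≡ true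
  p-next {t} t≤T f≤T with next t | firstFrom-view p (suc t) (T ∸ t) (suc T)
  ... | _ | none _            = contradiction f≤T (<⇒≱ ≤-refl)
  ... | _ | found _ _ pf _    = pf

  <next-of-gap : ∀ {t m} → t ≤ T → m ≤ T → (∀ j → t < j → j ≤ m → p j ≡ false) → m < next t
  <next-of-gap {t} {m} t≤T m≤T gap with m <? next t
  ... | yes m<f = m<f
  ... | no m≮f  = contradiction (trans (sym (p-next t≤T (≤-trans f≤m m≤T))) (gap (next t) (<next t≤T) f≤m)) λ ()
    where f≤m = ≮⇒≥ m≮f

module Prev (p : ℕ → Bool) where

  prev : ℕ → ℕ
  prev zero    = 0
  prev (suc t) = if p (suc t) then suc t else prev t

  prev-spec : ∀ {a} t → p a ≡ true → a ≤ t →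
              a ≤ prev t × prev t ≤ t × p (prev t) ≡ true × (∀ j → prev t < j → j ≤ t → p j ≡ false)
  prev-spec zero pa z≤n = z≤n , z≤n , pa , λ j 0<j j≤0 → contradiction j≤0 (<⇒≱ 0<j)
  prev-spec (suc t) pa a≤t with p (suc t) in pt
  ... | true = a≤t , ≤-refl , pt , λ j t<j j≤t → contradiction j≤t (<⇒≱ t<j)
  ... | false with m≤n⇒m<n∨m≡n a≤t
  ...   | inj₂ refl = contradiction (trans (sym pa) pt) λ ()
  ...   | inj₁ a<t with prev-spec t pa (s≤s⁻¹ a<t)
  ...     | a≤f , f≤t , pf , gap = a≤f , ≤-trans f≤t (n≤1+n t) , pf , extend
    where
    extend : ∀ j → prev t < j → j ≤ suc t → p j ≡ false
    extend j f<j j≤t with m≤n⇒m<n∨m≡n j≤t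
    ... | inj₁ j<t = gap j f<j (s≤s⁻¹ j<t)
    ... | inj₂ refl = pt

-- Decomposing a unit flow in D_T into a walk

module Decomposition (I : Instance) where
  open Instance I

  MoveFlow : Set
  MoveFlow = Fin n → Fin n → ℕ → Bool

  HoldFlow : Set
  HoldFlow = Fin n → ℕ → Bool

  outMove : MoveFlow → Fin n → ℕ → ℕ
  outMove X v t = ∑ (allFin n) (λ w → [ isMoveT I v w t ]· bit (X v w t))

  inMove : MoveFlow → Fin n → ℕ → ℕ
  inMove X v t = ∑ (allFin n) (λ w → ∑ (upTo (suc T)) (λ t' → [ arc w v ∧ (t' + τ w v ≡ᵇ t) ]· bit (X w v t')))

  outHold : HoldFlow → Fin n → ℕ → ℕ
  outHold H v t = [ t <ᵇ T ]· bit (H v t)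

  inHold : HoldFlow → Fin n → ℕ → ℕ
  inHold H v t = [ 0 <ᵇ t ]· bit (H v (t ∸ 1))

  atNode : Fin n → ℕ → Fin n → ℕ → Bool
  atNode v₀ t₀ v t = does ((v ≟ v₀) ×-dec (t ≟ℕ t₀))

  point : Fin n → ℕ → Fin n → ℕ → ℕ
  point v₀ t₀ v t = [ atNode v₀ t₀ v t ]· 1

  out : MoveFlow → HoldFlow → Fin n → ℕ → ℕ
  out X H v t = outMove X v t + outHold H v t

  inn : MoveFlow → HoldFlow → Fin n → ℕ → ℕ
  inn X H v t = inMove X v t + inHold H v t

  IsFlow : MoveFlow → HoldFlow → Fin n → ℕ → Fin n → ℕ → Set
  IsFlow X H s a z b = ∀ v t → t ≤ T → out X H v t + point z b v t ≡ inn X H v t + point s a v t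

  atNode-self : ∀ v t → atNode v t v t ≡ true
  atNode-self v t = dec-true ((v ≟ v) ×-dec (t ≟ℕ t)) (refl , refl)

  atNode-other : ∀ v₀ t₀ v t → ¬ (v ≡ v₀ × t ≡ t₀) → atNode v₀ t₀ v t ≡ false
  atNode-other v₀ t₀ v t = dec-false ((v ≟ v₀) ×-dec (t ≟ℕ t₀))

  atNode-true : ∀ {v₀ t₀ v t} → atNode v₀ t₀ v t ≡ true → v ≡ v₀ × t ≡ t₀
  atNode-true {v₀} {t₀} {v} {t} = from-does ((v ≟ v₀) ×-dec (t ≟ℕ t₀))

  point-self : ∀ v t → point v t v t ≡ 1
  point-self v t = cong ([_]· 1) (atNode-self v t)

  point-other : ∀ {v₀ t₀ v t} → ¬ (v ≡ v₀ × t ≡ t₀) → point v₀ t₀ v t ≡ 0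
  point-other {v₀} {t₀} {v} {t} ne = cong ([_]· 1) (atNode-other v₀ t₀ v t ne)

  isMoveT-arc : ∀ {v w t} → isMoveT I v w t ≡ true → arc v w ≡ true
  isMoveT-arc e = proj₁ (∧-true e)

  isMoveT-≤T : ∀ {v w t} → isMoveT I v w t ≡ true → t + τ v w ≤ T
  isMoveT-≤T e = from-does (_ ≤? _) (proj₂ (∧-true e))

  unitMove : Fin n → Fin n → ℕ → MoveFlow
  unitMove v₀ w₀ t₀ v w t = does ((v ≟ v₀) ×-dec ((w ≟ w₀) ×-dec (t ≟ℕ t₀)))

  unitMove-self : ∀ v w t → unitMove v w t v w t ≡ true
  unitMove-self v w t = dec-true ((v ≟ v) ×-dec ((w ≟ w) ×-dec (t ≟ℕ t))) (refl , refl , refl)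

  unitMove-true : ∀ {v₀ w₀ t₀ v w t} → unitMove v₀ w₀ t₀ v w t ≡ true → v ≡ v₀ × w ≡ w₀ × t ≡ t₀
  unitMove-true {v₀} {w₀} {t₀} {v} {w} {t} = from-does ((v ≟ v₀) ×-dec ((w ≟ w₀) ×-dec (t ≟ℕ t₀)))

  unitMove-other : ∀ v₀ w₀ t₀ v w t → ¬ (v ≡ v₀ × w ≡ w₀ × t ≡ t₀) → unitMove v₀ w₀ t₀ v w t ≡ false
  unitMove-other v₀ w₀ t₀ v w t = dec-false ((v ≟ v₀) ×-dec ((w ≟ w₀) ×-dec (t ≟ℕ t₀)))

  dropMove : MoveFlow → Fin n → Fin n → ℕ → MoveFlow
  dropMove X v₀ w₀ t₀ v w t = X v w t ∧ not (unitMove v₀ w₀ t₀ v w t)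

  dropHold : HoldFlow → Fin n → ℕ → HoldFlow
  dropHold H v₀ t₀ v t = H v t ∧ not (atNode v₀ t₀ v t)

  outMove-unit : ∀ {v₀ w₀ t₀} → isMoveT I v₀ w₀ t₀ ≡ true → ∀ v t →
                 outMove (unitMove v₀ w₀ t₀) v t ≡ point v₀ t₀ v t
  outMove-unit {v₀} {w₀} {t₀} mv v t with toSum ((v ≟ v₀) ×-dec (t ≟ℕ t₀))
  ... | inj₁ (refl , refl) =
    trans (∑-single _ (allFin⁺ n) (∈-allFin w₀) off)
          (trans (cong₂ (λ c u → [ c ]· bit u) mv (unitMove-self v₀ w₀ t₀)) (sym (point-self v₀ t₀)))
    where
    off : ∀ w → w ≢ w₀ → [ isMoveT I v₀ w t₀ ]· bit (unitMove v₀ w₀ t₀ v₀ w t₀) ≡ 0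
    off w w≢ = []·bit-false _ (unitMove-other v₀ w₀ t₀ v₀ w t₀ (w≢ ∘′ proj₁ ∘′ proj₂))
  ... | inj₂ ne =
    trans (∑-zero (allFin n) (λ w → []·bit-false _ (unitMove-other v₀ w₀ t₀ v w t (λ (p , _ , q) → ne (p , q)))))
          (sym (point-other ne))

  inMove-unit : ∀ {v₀ w₀ t₀} → isMoveT I v₀ w₀ t₀ ≡ true → ∀ v t →
                inMove (unitMove v₀ w₀ t₀) v t ≡ point w₀ (t₀ + τ v₀ w₀) v t
  inMove-unit {v₀} {w₀} {t₀} mv v t with toSum ((v ≟ w₀) ×-dec (t ≟ℕ t₀ + τ v₀ w₀))
  ... | inj₁ (refl , refl) =
    trans (∑-single _ (allFin⁺ n) (∈-allFin v₀) off-node)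
          (trans (∑-single _ (upTo⁺ (suc T)) (∈-upTo⁺ (s≤s t₀≤T)) off-time)
                 (trans (cong₂ (λ c u → [ c ∧ (t₀ + τ v₀ w₀ ≡ᵇ t₀ + τ v₀ w₀) ]· bit u)
                               (isMoveT-arc {t = t₀} mv) (unitMove-self v₀ w₀ t₀))
                        (trans (cong ([_]· 1) (dec-true (t₀ + τ v₀ w₀ ≟ℕ t₀ + τ v₀ w₀) refl))
                               (sym (point-self w₀ (t₀ + τ v₀ w₀))))))
    where
    t₀≤T = ≤-trans (m≤m+n t₀ (τ v₀ w₀)) (isMoveT-≤T {t = t₀} mv)
    off-node : ∀ w → w ≢ v₀ → ∑ (upTo (suc T)) (λ t' → [ arc w w₀ ∧ (t' + τ w w₀ ≡ᵇ t) ]· bit (unitMove v₀ w₀ t₀ w w₀ t')) ≡ 0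
    off-node w w≢ = ∑-zero (upTo (suc T)) (λ t' → []·bit-false _ (unitMove-other v₀ w₀ t₀ w w₀ t' (w≢ ∘′ proj₁)))
    off-time : ∀ t' → t' ≢ t₀ → [ arc v₀ w₀ ∧ (t' + τ v₀ w₀ ≡ᵇ t) ]· bit (unitMove v₀ w₀ t₀ v₀ w₀ t') ≡ 0
    off-time t' t'≢ = []·bit-false _ (unitMove-other v₀ w₀ t₀ v₀ w₀ t' (t'≢ ∘′ proj₂ ∘′ proj₂))
  ... | inj₂ ne = trans (∑-zero (allFin n) (λ w → ∑-zero (upTo (suc T)) (term w))) (sym (point-other ne))
    where
    term : ∀ w t' → [ arc w v ∧ (t' + τ w v ≡ᵇ t) ]· bit (unitMove v₀ w₀ t₀ w v t') ≡ 0
    term w t' with toSum ((w ≟ v₀) ×-dec ((v ≟ w₀) ×-dec (t' ≟ℕ t₀)))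
    ... | inj₂ other = []·bit-false _ (unitMove-other v₀ w₀ t₀ w v t' other)
    ... | inj₁ (refl , refl , refl) =
      []·-false _ (∧-falseʳ (arc v₀ w₀) (dec-false (t₀ + τ v₀ w₀ ≟ℕ t) (ne ∘′ (refl ,_) ∘′ sym)))

  outHold-unit : ∀ {v₀ t₀} → t₀ < T → ∀ v t → outHold (atNode v₀ t₀) v t ≡ point v₀ t₀ v t
  outHold-unit {v₀} {t₀} t₀<T v t with toSum ((v ≟ v₀) ×-dec (t ≟ℕ t₀))
  ... | inj₁ (refl , refl) = trans (cong₂ (λ c u → [ c ]· bit u) (dec-true (t₀ <? T) t₀<T) (atNode-self v₀ t₀))
                                   (sym (point-self v₀ t₀))
  ... | inj₂ ne = trans ([]·bit-false _ (atNode-other v₀ t₀ v t ne)) (sym (point-other ne))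

  inHold-unit : ∀ v₀ t₀ v t → inHold (atNode v₀ t₀) v t ≡ point v₀ (suc t₀) v t
  inHold-unit v₀ t₀ v zero    = sym ([]·-false 1 (∧-zeroʳ (does (v ≟ v₀))))
  inHold-unit v₀ t₀ v (suc t) = sym ([]·1≡bit _)

  outMove-drop : ∀ X {v₀ w₀ t₀} → X v₀ w₀ t₀ ≡ true → ∀ v t →
                 outMove X v t ≡ outMove (dropMove X v₀ w₀ t₀) v t + outMove (unitMove v₀ w₀ t₀) v t
  outMove-drop X {v₀} {w₀} {t₀} Xe v t =
    trans (∑-cong (allFin n) (λ w → trans (cong ([ isMoveT I v w t ]·_) (bit-drop (X v w t) (covered w)))
                                          ([]·-+ (isMoveT I v w t) _ _)))
          (∑-+ (allFin n) _ _)
    where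
    covered : ∀ w → unitMove v₀ w₀ t₀ v w t ≡ true → X v w t ≡ true
    covered w u with unitMove-true {v₀} {w₀} {t₀} {v} {w} {t} u
    ... | refl , refl , refl = Xe

  inMove-drop : ∀ X {v₀ w₀ t₀} → X v₀ w₀ t₀ ≡ true → ∀ v t →
                inMove X v t ≡ inMove (dropMove X v₀ w₀ t₀) v t + inMove (unitMove v₀ w₀ t₀) v t
  inMove-drop X {v₀} {w₀} {t₀} Xe v t =
    trans (∑-cong (allFin n) (λ w → trans (∑-cong (upTo (suc T)) (λ t' → trans (cong ([ enters w t' ]·_) (bit-drop (X w v t') (covered w t')))
                                                                                ([]·-+ (enters w t') _ _)))
                                          (∑-+ (upTo (suc T)) (term (dropMove X v₀ w₀ t₀) w) (term (unitMove v₀ w₀ t₀) w))))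
          (∑-+ (allFin n) _ _)
    where
    enters : Fin n → ℕ → Bool
    enters w t' = arc w v ∧ (t' + τ w v ≡ᵇ t)
    term : MoveFlow → Fin n → ℕ → ℕ
    term Y w t' = [ enters w t' ]· bit (Y w v t')
    covered : ∀ w t' → unitMove v₀ w₀ t₀ w v t' ≡ true → X w v t' ≡ true
    covered w t' u with unitMove-true {v₀} {w₀} {t₀} {w} {v} {t'} u
    ... | refl , refl , refl = Xe

  outHold-drop : ∀ H {v₀ t₀} → H v₀ t₀ ≡ true → ∀ v t →
                 outHold H v t ≡ outHold (dropHold H v₀ t₀) v t + outHold (atNode v₀ t₀) v t
  outHold-drop H {v₀} {t₀} He v t = trans (cong ([ t <ᵇ T ]·_) (bit-drop (H v t) covered)) ([]·-+ (t <ᵇ T) _ _)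
    where
    covered : atNode v₀ t₀ v t ≡ true → H v t ≡ true
    covered u with atNode-true {v₀} {t₀} {v} {t} u
    ... | refl , refl = He

  inHold-drop : ∀ H {v₀ t₀} → H v₀ t₀ ≡ true → ∀ v t →
                inHold H v t ≡ inHold (dropHold H v₀ t₀) v t + inHold (atNode v₀ t₀) v t
  inHold-drop H {v₀} {t₀} He v t = trans (cong ([ 0 <ᵇ t ]·_) (bit-drop (H v (t ∸ 1)) covered)) ([]·-+ (0 <ᵇ t) _ _)
    where
    covered : atNode v₀ t₀ v (t ∸ 1) ≡ true → H v (t ∸ 1) ≡ true
    covered u with atNode-true {v₀} {t₀} {v} {t ∸ 1} u
    ... | refl , refl = He

  private
    +-swap-last : ∀ a b c → (a + b) + c ≡ (a + c) + b
    +-swap-last = solve-∀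

    reroute : ∀ {o i z p q} o' i' → o + z ≡ i + p → o ≡ o' + p → i ≡ i' + q → o' + z ≡ i' + q
    reroute {o} {i} {z} {p} {q} o' i' balance o≡ i≡ = +-cancelʳ-≡ p (o' + z) (i' + q) (begin
      (o' + z) + p ≡⟨ +-swap-last o' z p ⟩
      (o' + p) + z ≡⟨ cong (_+ z) (sym o≡) ⟩
      o + z        ≡⟨ balance ⟩
      i + p        ≡⟨ cong (_+ p) i≡ ⟩
      (i' + q) + p ∎)
      where open ≡-Reasoning

  out-dropMove : ∀ X H {s a w} → X s w a ≡ true → isMoveT I s w a ≡ true → ∀ v t →
                 out X H v t ≡ out (dropMove X s w a) H v t + point s a v t
  out-dropMove X H {s} {a} {w} Xe mv v t =
    trans (cong (_+ outHold H v t) (trans (outMove-drop X Xe v t) (cong (outMove (dropMove X s w a) v t +_) (outMove-unit mv v t))))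
          (+-swap-last (outMove (dropMove X s w a) v t) _ _)

  inn-dropMove : ∀ X H {s a w} → X s w a ≡ true → isMoveT I s w a ≡ true → ∀ v t →
                 inn X H v t ≡ inn (dropMove X s w a) H v t + point w (a + τ s w) v t
  inn-dropMove X H {s} {a} {w} Xe mv v t =
    trans (cong (_+ inHold H v t) (trans (inMove-drop X Xe v t) (cong (inMove (dropMove X s w a) v t +_) (inMove-unit mv v t))))
          (+-swap-last (inMove (dropMove X s w a) v t) _ _)

  out-dropHold : ∀ X H {s a} → H s a ≡ true → a < T → ∀ v t →
                 out X H v t ≡ out X (dropHold H s a) v t + point s a v t
  out-dropHold X H {s} {a} He a<T v t =
    trans (cong (outMove X v t +_) (trans (outHold-drop H He v t) (cong (outHold (dropHold H s a) v t +_) (outHold-unit a<T v t))))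
          (sym (+-assoc (outMove X v t) (outHold (dropHold H s a) v t) _))

  inn-dropHold : ∀ X H {s a} → H s a ≡ true → ∀ v t →
                 inn X H v t ≡ inn X (dropHold H s a) v t + point s (suc a) v t
  inn-dropHold X H {s} {a} He v t =
    trans (cong (inMove X v t +_) (trans (inHold-drop H He v t) (cong (inHold (dropHold H s a) v t +_) (inHold-unit s a v t))))
          (sym (+-assoc (inMove X v t) (inHold (dropHold H s a) v t) _))

  IsFlow-dropMove : ∀ {X H s a w z b} → IsFlow X H s a z b → X s w a ≡ true → isMoveT I s w a ≡ true →
                    IsFlow (dropMove X s w a) H w (a + τ s w) z b
  IsFlow-dropMove {X} {H} {s} {a} {w} flow Xe mv v t t≤T =
    reroute (out (dropMove X s w a) H v t) (inn (dropMove X s w a) H v t) (flow v t t≤T)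
            (out-dropMove X H Xe mv v t) (inn-dropMove X H Xe mv v t)

  IsFlow-dropHold : ∀ {X H s a z b} → IsFlow X H s a z b → H s a ≡ true → a < T →
                    IsFlow X (dropHold H s a) s (suc a) z b
  IsFlow-dropHold {X} {H} {s} {a} flow He a<T v t t≤T =
    reroute (out X (dropHold H s a) v t) (inn X (dropHold H s a) v t) (flow v t t≤T)
            (out-dropHold X H He a<T v t) (inn-dropHold X H He v t)

  size : MoveFlow → HoldFlow → ℕ
  size X H = ∑ (allFin n) (λ v → ∑ (upTo (suc T)) (out X H v))

  size-shrinks : ∀ {X H X' H' s a} → a ≤ T → (∀ v t → out X H v t ≡ out X' H' v t + point s a v t) →
                 size X' H' < size X H
  size-shrinks {X} {H} {X'} {H'} {s} {a} a≤T split =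
    ∑-mono-< (∈-allFin s) (λ v → ∑-mono (upTo (suc T)) (λ t → out≤ v t))
             (∑-mono-< (∈-upTo⁺ (s≤s a≤T)) (out≤ s) (subst (out X' H' s a <_) (sym (split s a)) strict))
    where
    out≤ : ∀ v t → out X' H' v t ≤ out X H v t
    out≤ v t = subst (out X' H' v t ≤_) (sym (split v t)) (m≤m+n _ _)
    strict : out X' H' s a < out X' H' s a + point s a s a
    strict = m<m+n (out X' H' s a) (subst (0 <_) (sym (point-self s a)) z<s)

  data WalkT (X : MoveFlow) (H : HoldFlow) (z : Fin n) (b : ℕ) : Fin n → ℕ → Set where
    []   : WalkT X H z b z b
    move : ∀ {v t} w → isMoveT I v w t ≡ true → X v w t ≡ true → WalkT X H z b w (t + τ v w) → WalkT X H z b v t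
    hold : ∀ {v t} → t < T → H v t ≡ true → WalkT X H z b v (suc t) → WalkT X H z b v t

  WalkT-⊆ : ∀ {X H X' H' z b v t} → (∀ {v w t} → X v w t ≡ true → X' v w t ≡ true) → (∀ {v t} → H v t ≡ true → H' v t ≡ true) →
            WalkT X H z b v t → WalkT X' H' z b v t
  WalkT-⊆ X⊆ H⊆ []                  = []
  WalkT-⊆ X⊆ H⊆ (move w mv Xe rest) = move w mv (X⊆ Xe) (WalkT-⊆ X⊆ H⊆ rest)
  WalkT-⊆ X⊆ H⊆ (hold t<T He rest)  = hold t<T (H⊆ He) (WalkT-⊆ X⊆ H⊆ rest)

  departure : ∀ X H v t → 0 < out X H v t →
              (∃ λ w → isMoveT I v w t ≡ true × X v w t ≡ true) ⊎ (t < T × H v t ≡ true)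
  departure X H v t pos with outMove X v t in moves
  ... | suc _ with ∑-pos (allFin n) (λ w → [ isMoveT I v w t ]· bit (X v w t)) (subst (0 <_) (sym moves) z<s)
  ...   | w , _ , term>0 = inj₁ (w , []·bit-pos _ _ term>0)
  departure X H v t pos | zero with []·bit-pos (t <ᵇ T) (H v t) pos
  ...   | lt , He = inj₂ (from-does (t <? T) lt , He)

  source-leaves : ∀ {X H s a z b} → IsFlow X H s a z b → a ≤ T → ¬ (s ≡ z × a ≡ b) → 0 < out X H s a
  source-leaves {X} {H} {s} {a} flow a≤T ne = subst (0 <_) (sym balance) z<s
    where
    open ≡-Reasoning
    balance : out X H s a ≡ suc (inn X H s a)
    balance = begin
      out X H s a                    ≡⟨ sym (+-identityʳ _) ⟩
      out X H s a + 0                ≡⟨ cong (out X H s a +_) (sym (point-other ne)) ⟩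
      out X H s a + point _ _ s a    ≡⟨ flow s a a≤T ⟩
      inn X H s a + point s a s a    ≡⟨ cong (inn X H s a +_) (point-self s a) ⟩
      inn X H s a + 1                ≡⟨ +-comm _ 1 ⟩
      suc (inn X H s a)              ∎

  walk-of-flow : ∀ {X H s a z b} → a ≤ T → IsFlow X H s a z b → WalkT X H z b s a
  walk-of-flow {X} {H} = go (suc (size X H)) ≤-refl
    where
    go : ∀ N {X H s a z b} → size X H < N → a ≤ T → IsFlow X H s a z b → WalkT X H z b s a
    go (suc N) {X} {H} {s} {a} {z} {b} bound a≤T flow with toSum ((s ≟ z) ×-dec (a ≟ℕ b))
    ... | inj₁ (refl , refl) = []
    ... | inj₂ ne with departure X H s a (source-leaves flow a≤T ne)
    ... | inj₁ (w , mv , Xe) =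
      move w mv Xe (WalkT-⊆ (proj₁ ∘′ ∧-true {X _ _ _}) id
        (go N (≤-trans (size-shrinks a≤T (out-dropMove X H Xe mv)) (s≤s⁻¹ bound)) (isMoveT-≤T {t = a} mv) (IsFlow-dropMove flow Xe mv)))
    ... | inj₂ (a<T , He) =
      hold a<T He (WalkT-⊆ id (proj₁ ∘′ ∧-true {H _ _})
        (go N (≤-trans (size-shrinks a≤T (out-dropHold X H He a<T)) (s≤s⁻¹ bound)) a<T (IsFlow-dropHold flow He a<T)))

-- Following a walk of D_T in D_S

module Simulation (I : Instance) (S : PTEN I) (V : Valid I S) (x : MoveVarsT I) (h : HoldVarsT I) where
  open Instance I
  open PTEN S
  open Valid V
  open Decomposition I

  <nS : ∀ {v t} → t ≤ T → t < nS I S v t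
  <nS {v} = Next.<next T (inS v)

  nS-gap : ∀ {v t j} → t ≤ T → t < j → j < nS I S v t → inS v j ≡ false
  nS-gap {v} = Next.gap-before-next T (inS v)

  inS-nS : ∀ {v t} → t ≤ T → nS I S v t ≤ T → inS v (nS I S v t) ≡ true
  inS-nS {v} = Next.p-next T (inS v)

  <nS-of-gap : ∀ {v t m} → t ≤ T → m ≤ T → (∀ j → t < j → j ≤ m → inS v j ≡ false) → m < nS I S v t
  <nS-of-gap {v} = Next.<next-of-gap T (inS v)

  no-node-after-arc : ∀ {v t w t' j} → inAS v t w t' ≡ true → t' < j → j ≤ t + τ v w → inS w j ≡ false
  no-node-after-arc {v} {t} {w} {t'} {j} e t'<j j≤ with inS w j in node
  ... | false = refl
  ... | true  = contradiction (j , node , t'<j , j≤) (P4 v t w t' e)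

  incoming : Fin n → ℕ → Fin n → ℕ → Bool
  incoming w t' v t = (arc w v ∧ (t' + τ w v ≡ᵇ t)) ∨ inAS w t' v t

  record ArcUse (k : Fin K) (v : Fin n) (a : ℕ) (w : Fin n) : Set where
    constructor departs-at
    field
      time     : ℕ
      a≤time   : a ≤ time
      time<nS  : time < nS I S v a
      isMove   : isMoveT I v w time ≡ true
      used     : x k v w time ≡ true

  -- The three cases are paid for by b_v, by the second b_v of a gap, and by U_e.
  data HoldUse (k : Fin K) (v : Fin n) (c : ℕ) : Set where
    held-at     : h k v c ≡ true → HoldUse k v c
    held-before : inS v (suc c) ≡ false → h k v (nS I S v c ∸ 1) ≡ true → HoldUse k v c
    passing     : ∀ w t' s → t' ≤ T → incoming w t' v c ≡ true → t' < s → s < nS I S w t' →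
                  isMoveT I w v s ≡ true → x k w v s ≡ true → HoldUse k v c

  data WalkS (k : Fin K) (r : Fin n) (e : ℕ) : Fin n → ℕ → Set where
    []   : WalkS k r e r e
    move : ∀ {v a w b} → inAS v a w b ≡ true → ArcUse k v a w → WalkS k r e w b → WalkS k r e v a
    hold : ∀ {v a} → isHold I S v a ≡ true → HoldUse k v a → WalkS k r e v (nS I S v a) → WalkS k r e v a

  data Arrival (k : Fin K) (v : Fin n) (a : ℕ) : ℕ → Set where
    origin : Arrival k v a 0
    via    : ∀ {w f} (u : ArcUse k w f v) → inAS w f v a ≡ true → Arrival k v a (ArcUse.time u + τ w v)

  -- The D_T walk is at (v, t), the D_S walk at (v, a), and in D_T the packet has been at v since x₀.
  record Tracking (k : Fin K) (v : Fin n) (t a x₀ : ℕ) : Set where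
    field
      inS-a   : inS v a ≡ true
      a≤x₀    : a ≤ x₀
      x₀≤t    : x₀ ≤ t
      t≤T     : t ≤ T
      held    : ∀ j → x₀ ≤ j → j < t → h k v j ≡ true
      arrival : Arrival k v a x₀

  -- If c ≤ f + τ then c = a by (P4) and the D_S arc itself enters (v, c); otherwise the D_T arc
  -- from (w, c − τ) does.
  passing-after-arrival : ∀ {k v a c x₀} → Arrival k v a x₀ → a ≤ c → inS v c ≡ true → c < x₀ → nS I S v c ≤ x₀ → x₀ ≤ T →
                          HoldUse k v c
  passing-after-arrival origin _ _ () _ _
  passing-after-arrival {k} {v} {a} {c} (via {w} {f} (departs-at s f≤s s<nS mv used) e) a≤c inS-c c<x₀ nS≤x₀ x₀≤T
    with c ≤? f + τ w v
  ... | yes c≤fτ = passing w f s f≤T (subst (λ c → incoming w f v c ≡ true) (sym c≡a) (trans (cong (_ ∨_) e) (∨-zeroʳ _))) f<s s<nS mv used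
    where
    f≤T = NS⊆NT w f (proj₁ (AS-ends w f v a e))
    c≡a : c ≡ a
    c≡a with a <? c
    ... | yes a<c = ⊥-elim (clash inS-c (no-node-after-arc e a<c c≤fτ))
    ... | no a≮c  = ≤-antisym (≮⇒≥ a≮c) a≤c
    f<s : f < s
    f<s with m≤n⇒m<n∨m≡n f≤s
    ... | inj₁ f<s = f<s
    ... | inj₂ refl = ⊥-elim (clash (inS-nS c≤T (≤-trans nS≤x₀ x₀≤T)) (no-node-after-arc e (subst (_< nS I S v c) c≡a (<nS c≤T)) nS≤x₀))
      where c≤T = ≤-trans (<⇒≤ c<x₀) x₀≤T
  ... | no c≰fτ = passing w t' s t'≤T enters t'<s (<nS-of-gap t'≤T s≤T gap) mv used
    where
    τ≤c = ≤-trans (m≤n+m (τ w v) f) (<⇒≤ (≰⇒> c≰fτ))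
    t' = c ∸ τ w v
    t'+τ≡c : t' + τ w v ≡ c
    t'+τ≡c = m∸n+n≡m τ≤c
    t'≤T = ≤-trans (m∸n≤m c (τ w v)) (≤-trans (<⇒≤ c<x₀) x₀≤T)
    s≤T = ≤-trans (m≤m+n s (τ w v)) x₀≤T
    enters : incoming w t' v c ≡ true
    enters rewrite isMoveT-arc {t = s} mv | t'+τ≡c | dec-true (c ≟ℕ c) refl = refl
    t'<s : t' < s
    t'<s = +-cancelʳ-< (τ w v) t' s (subst (_< s + τ w v) (sym t'+τ≡c) c<x₀)
    f<t' : f < t'
    f<t' = +-cancelʳ-< (τ w v) f t' (subst (f + τ w v <_) (sym t'+τ≡c) (≰⇒> c≰fτ))
    gap : ∀ j → t' < j → j ≤ s → inS w j ≡ false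
    gap j t'<j j≤s = nS-gap (NS⊆NT w f (proj₁ (AS-ends w f v a e))) (<-trans f<t' t'<j) (≤-<-trans j≤s s<nS)

  nS-≤-next-node : ∀ {v c f} → c ≤ T → c < f → inS v f ≡ true → nS I S v c ≤ f
  nS-≤-next-node {v} {c} {f} c≤T c<f inS-f with f <? nS I S v c
  ... | yes f<nS = ⊥-elim (clash inS-f (nS-gap c≤T c<f f<nS))
  ... | no f≮nS  = ≮⇒≥ f≮nS

  isHold-intro : ∀ {v c} → inS v c ≡ true → c < T → nS I S v c ≤ T → isHold I S v c ≡ true
  isHold-intro {v} {c} inS-c c<T nS≤T rewrite inS-c | dec-true (c <? T) c<T | dec-true (nS I S v c ≤? T) nS≤T = refl

  isHold-< : ∀ {v c} → isHold I S v c ≡ true → c < T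
  isHold-< {v} {c} hd = from-does (c <? T) (proj₁ (∧-true (proj₂ (∧-true {inS v c} hd))))

  isHold-nS≤T : ∀ {v c} → isHold I S v c ≡ true → nS I S v c ≤ T
  isHold-nS≤T {v} {c} hd = from-does (nS I S v c ≤? T) (proj₂ (∧-true {c <ᵇ T} (proj₂ (∧-true {inS v c} hd))))

  module _ {k : Fin K} {v : Fin n} {t a x₀ : ℕ} (tr : Tracking k v t a x₀) where
    open Tracking tr

    hold-use : ∀ {c} → a ≤ c → inS v c ≡ true → nS I S v c ≤ t → HoldUse k v c
    hold-use {c} a≤c inS-c nS≤t with x₀ ≤? c | x₀ <? nS I S v c
    ... | yes x₀≤c | _        = held-at (held c x₀≤c (<-≤-trans (<nS c≤T) nS≤t))
      where c≤T = NS⊆NT v c inS-c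
    ... | no x₀≰c  | yes x₀<nS =
      held-before (nS-gap c≤T ≤-refl (≤-<-trans (≰⇒> x₀≰c) x₀<nS)) (held _ (pred-≤ x₀<nS) (pred-< (<nS c≤T) nS≤t))
      where
      c≤T = NS⊆NT v c inS-c
      pred-≤ : ∀ {m} → x₀ < m → x₀ ≤ m ∸ 1
      pred-≤ {suc m} x₀<m = s≤s⁻¹ x₀<m
      pred-< : ∀ {m} → c < m → m ≤ t → m ∸ 1 < t
      pred-< {suc m} _ m≤t = m≤t
    ... | no x₀≰c  | no x₀≮nS = passing-after-arrival arrival a≤c inS-c (≰⇒> x₀≰c) (≮⇒≥ x₀≮nS) (≤-trans x₀≤t t≤T)

    hold-through : ∀ {r e} d {c f} → f ∸ c ≤ d → a ≤ c → c ≤ f → inS v c ≡ true → inS v f ≡ true → f ≤ t →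
                   WalkS k r e v f → WalkS k r e v c
    hold-through {r} {e} zero {c} {f} f∸c≤0 a≤c c≤f inS-c inS-f f≤t W =
      subst (WalkS k r e v) (≤-antisym (m∸n≡0⇒m≤n (n≤0⇒n≡0 f∸c≤0)) c≤f) W
    hold-through {r} {e} (suc d) {c} {f} f∸c≤d a≤c c≤f inS-c inS-f f≤t W with c <? f
    ... | no c≮f  = subst (WalkS k r e v) (≤-antisym (≮⇒≥ c≮f) c≤f) W
    ... | yes c<f = hold (isHold-intro inS-c (<-≤-trans c<f f≤T) nS≤T) (hold-use a≤c inS-c (≤-trans nS≤f f≤t))
                         (hold-through d (s≤s⁻¹ (≤-trans (∸-monoʳ-< c<nS nS≤f) f∸c≤d)) (≤-trans a≤c (<⇒≤ c<nS)) nS≤f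
                                       (inS-nS c≤T nS≤T) inS-f f≤t W)
      where
      c≤T = NS⊆NT v c inS-c
      f≤T = ≤-trans f≤t t≤T
      c<nS = <nS c≤T
      nS≤f = nS-≤-next-node c≤T c<f inS-f
      nS≤T = ≤-trans nS≤f f≤T

  simulate : ∀ {k v t a x₀} → WalkT (x k) (h k) (dst k) T v t → Tracking k v t a x₀ → WalkS k (dst k) T v a
  simulate {k} {a = a} [] tr = hold-through tr (T ∸ a) ≤-refl ≤-refl a≤T inS-a (P1-dst k) ≤-refl []
    where
    open Tracking tr
    a≤T = ≤-trans a≤x₀ (≤-trans x₀≤t t≤T)
  simulate {k} {v} {t} {a} {x₀} (hold t<T He rest) tr = simulate rest record
    { inS-a = inS-a ; a≤x₀ = a≤x₀ ; x₀≤t = ≤-trans x₀≤t (n≤1+n t) ; t≤T = t<T ; held = held′ ; arrival = arrival }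
    where
    open Tracking tr
    held′ : ∀ j → x₀ ≤ j → j < suc t → h k v j ≡ true
    held′ j x₀≤j j<1+t with m≤n⇒m<n∨m≡n (s≤s⁻¹ j<1+t)
    ... | inj₁ j<t  = held j x₀≤j j<t
    ... | inj₂ refl = He
  simulate {k} {v} {t} {a} (move w mv Xe rest) tr
    with Prev.prev-spec (inS v) t (Tracking.inS-a tr) (≤-trans (Tracking.a≤x₀ tr) (Tracking.x₀≤t tr))
  ... | a≤f , f≤t , inS-f , gap with P3 v w f (isMoveT-arc {t = t} mv) inS-f (≤-trans (+-monoˡ-≤ (τ v w) f≤t) (isMoveT-≤T {t = t} mv))
    where f = Prev.prev (inS v) t
  ... | b , e = hold-through tr (f ∸ a) ≤-refl ≤-refl a≤f (Tracking.inS-a tr) inS-f f≤t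
                  (move e use (simulate rest tracking))
    where
    f = Prev.prev (inS v) t
    use : ArcUse k v f w
    use = departs-at t f≤t (<nS-of-gap (NS⊆NT v f inS-f) (Tracking.t≤T tr) gap) mv Xe
    tracking : Tracking k w (t + τ v w) b (t + τ v w)
    tracking = record
      { inS-a = proj₁ (proj₂ (AS-ends v f w b e)) ; a≤x₀ = ≤-trans (P2 v f w b e) (+-monoˡ-≤ (τ v w) f≤t) ; x₀≤t = ≤-refl
      ; t≤T = isMoveT-≤T {t = t} mv ; held = λ j t≤j j<t → contradiction t≤j (<⇒≱ j<t) ; arrival = via use e }

-- Flows of simple walks in D_S

module WalkFlow (I : Instance) (S : PTEN I) (V : Valid I S) (x : MoveVarsT I) (h : HoldVarsT I) where
  open Instance I
  open PTEN S
  open Valid V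
  open Decomposition I
  open Simulation I S V x h

  ArcsS : Set
  ArcsS = Fin n → ℕ → Fin n → ℕ → Bool

  HoldsS : Set
  HoldsS = Fin n → ℕ → Bool

  outArcs : ArcsS → Fin n → ℕ → ℕ
  outArcs Y p q = ∑ (allFin n) (λ w → ∑ (upTo (suc T)) (λ b → [ inAS p q w b ]· bit (Y p q w b)))

  inArcs : ArcsS → Fin n → ℕ → ℕ
  inArcs Y p q = ∑ (allFin n) (λ w → ∑ (upTo (suc T)) (λ a → [ inAS w a p q ]· bit (Y w a p q)))

  outHolds : HoldsS → Fin n → ℕ → ℕ
  outHolds G p q = [ isHold I S p q ]· bit (G p q)

  inHolds : HoldsS → Fin n → ℕ → ℕ
  inHolds G p q = ∑ (upTo (suc T)) (λ c → [ isHold I S p c ∧ (nS I S p c ≡ᵇ q) ]· bit (G p c))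

  arcAt : Fin n → ℕ → Fin n → ℕ → ArcsS
  arcAt v a w b p q p' q' = atNode v a p q ∧ atNode w b p' q'

  outArcs-arcAt : ∀ {v a w b} → inAS v a w b ≡ true → b ≤ T → ∀ p q → outArcs (arcAt v a w b) p q ≡ bit (atNode v a p q)
  outArcs-arcAt {v} {a} {w} {b} e b≤T p q with toSum ((p ≟ v) ×-dec (q ≟ℕ a))
  ... | inj₂ ne = trans (∑-zero (allFin n) (λ w' → ∑-zero (upTo (suc T)) (λ b' → []·bit-false _ (cong (_∧ _) (atNode-other v a p q ne)))))
                        (cong bit (sym (atNode-other v a p q ne)))
  ... | inj₁ (refl , refl) =
    trans (∑-single _ (allFin⁺ n) (∈-allFin w) off-node)
          (trans (∑-single _ (upTo⁺ (suc T)) (∈-upTo⁺ (s≤s b≤T)) off-time)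
                 (trans (cong₂ (λ c u → [ c ]· bit (u ∧ atNode w b w b)) e (atNode-self v a))
                        (cong bit (trans (atNode-self w b) (sym (atNode-self v a))))))
    where
    off-node : ∀ w' → w' ≢ w → ∑ (upTo (suc T)) (λ b' → [ inAS v a w' b' ]· bit (arcAt v a w b v a w' b')) ≡ 0
    off-node w' w'≢ = ∑-zero (upTo (suc T)) (λ b' → []·bit-false _ (∧-falseʳ (atNode v a v a) (atNode-other w b w' b' (w'≢ ∘′ proj₁))))
    off-time : ∀ b' → b' ≢ b → [ inAS v a w b' ]· bit (arcAt v a w b v a w b') ≡ 0
    off-time b' b'≢ = []·bit-false _ (∧-falseʳ (atNode v a v a) (atNode-other w b w b' (b'≢ ∘′ proj₂)))

  inArcs-arcAt : ∀ {v a w b} → inAS v a w b ≡ true → a ≤ T → ∀ p q → inArcs (arcAt v a w b) p q ≡ bit (atNode w b p q)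
  inArcs-arcAt {v} {a} {w} {b} e a≤T p q with toSum ((p ≟ w) ×-dec (q ≟ℕ b))
  ... | inj₂ ne = trans (∑-zero (allFin n) (λ v' → ∑-zero (upTo (suc T)) (λ a' → []·bit-false _ (∧-falseʳ (atNode v a v' a') (atNode-other w b p q ne)))))
                        (cong bit (sym (atNode-other w b p q ne)))
  ... | inj₁ (refl , refl) =
    trans (∑-single _ (allFin⁺ n) (∈-allFin v) off-node)
          (trans (∑-single _ (upTo⁺ (suc T)) (∈-upTo⁺ (s≤s a≤T)) off-time)
                 (cong₂ (λ c u → [ c ]· bit (u ∧ atNode w b w b)) e (atNode-self v a)))
    where
    off-node : ∀ v' → v' ≢ v → ∑ (upTo (suc T)) (λ a' → [ inAS v' a' w b ]· bit (arcAt v a w b v' a' w b)) ≡ 0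
    off-node v' v'≢ = ∑-zero (upTo (suc T)) (λ a' → []·bit-false _ (cong (_∧ _) (atNode-other v a v' a' (v'≢ ∘′ proj₁))))
    off-time : ∀ a' → a' ≢ a → [ inAS v a' w b ]· bit (arcAt v a w b v a' w b) ≡ 0
    off-time a' a'≢ = []·bit-false _ (cong (_∧ _) (atNode-other v a v a' (a'≢ ∘′ proj₂)))

  outHolds-atNode : ∀ {v a} → isHold I S v a ≡ true → ∀ p q → outHolds (atNode v a) p q ≡ bit (atNode v a p q)
  outHolds-atNode {v} {a} hd p q with toSum ((p ≟ v) ×-dec (q ≟ℕ a))
  ... | inj₁ (refl , refl) = cong (λ c → [ c ]· bit (atNode v a v a)) hd
  ... | inj₂ ne = trans ([]·bit-false _ (atNode-other v a p q ne)) (cong bit (sym (atNode-other v a p q ne)))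

  inHolds-atNode : ∀ {v a} → isHold I S v a ≡ true → ∀ p q → inHolds (atNode v a) p q ≡ bit (atNode v (nS I S v a) p q)
  inHolds-atNode {v} {a} hd p q with toSum (p ≟ v)
  ... | inj₂ p≢v = trans (∑-zero (upTo (suc T)) (λ c → []·bit-false _ (atNode-other v a p c (p≢v ∘′ proj₁))))
                         (cong bit (sym (atNode-other v (nS I S v a) p q (p≢v ∘′ proj₁))))
  ... | inj₁ refl =
    trans (∑-single _ (upTo⁺ (suc T)) (∈-upTo⁺ (s≤s (<⇒≤ (isHold-< hd)))) off-time)
          (trans (cong₂ (λ c u → [ c ∧ (nS I S v a ≡ᵇ q) ]· bit u) hd (atNode-self v a))
                 (trans ([]·1≡bit _) (cong bit (trans (≡ᵇ-comm (nS I S v a) q) (cong (_∧ (q ≡ᵇ nS I S v a)) (sym (dec-true (v ≟ v) refl)))))))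
    where
    off-time : ∀ c → c ≢ a → [ isHold I S v c ∧ (nS I S v c ≡ᵇ q) ]· bit (atNode v a v c) ≡ 0
    off-time c c≢ = []·bit-false _ (atNode-other v a v c (c≢ ∘′ proj₂))

  module _ {k : Fin K} {r : Fin n} {d : ℕ} where

    visits : ∀ {v a} → WalkS k r d v a → Fin n → ℕ → Bool
    visits {v} {a} []           p q = atNode v a p q
    visits {v} {a} (move _ _ W) p q = atNode v a p q ∨ visits W p q
    visits {v} {a} (hold _ _ W) p q = atNode v a p q ∨ visits W p q

    arcs : ∀ {v a} → WalkS k r d v a → ArcsS
    arcs []                               = λ _ _ _ _ → false
    arcs (move {v} {a} {w} {b} _ _ W) p q p' q' = arcAt v a w b p q p' q' ∨ arcs W p q p' q'
    arcs (hold _ _ W)                     = arcs W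

    holds : ∀ {v a} → WalkS k r d v a → HoldsS
    holds []                       = λ _ _ → false
    holds (move _ _ W)             = holds W
    holds (hold {v} {a} _ _ W) p q = atNode v a p q ∨ holds W p q

    -- Transit times may be 0, so walks can revisit nodes; only simple walks give 0/1 flows.
    Simple : ∀ {v a} → WalkS k r d v a → Set
    Simple []                   = ⊤
    Simple (move {v} {a} _ _ W) = visits W v a ≡ false × Simple W
    Simple (hold {v} {a} _ _ W) = visits W v a ≡ false × Simple W

    arcs⇒visits : ∀ {v a} (W : WalkS k r d v a) {p q p' q'} → arcs W p q p' q' ≡ true → visits W p q ≡ true
    arcs⇒visits (move {v} {a} {w} {b} _ _ W) {p} {q} {p'} {q'} used with ∨-true (arcAt v a w b p q p' q') used
    ... | inj₁ first = ∨-trueˡ (visits W p q) (proj₁ (∧-true {atNode v a p q} first))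
    ... | inj₂ rest = ∨-trueʳ (atNode v a p q) (arcs⇒visits W rest)
    arcs⇒visits (hold {v} {a} _ _ W) {p} {q} used = ∨-trueʳ (atNode v a p q) (arcs⇒visits W used)

    holds⇒visits : ∀ {v a} (W : WalkS k r d v a) {p q} → holds W p q ≡ true → visits W p q ≡ true
    holds⇒visits (move {v} {a} _ _ W) {p} {q} used = ∨-trueʳ (atNode v a p q) (holds⇒visits W used)
    holds⇒visits (hold {v} {a} _ _ W) {p} {q} used with ∨-true (atNode v a p q) used
    ... | inj₁ first = ∨-trueˡ _ first
    ... | inj₂ rest = ∨-trueʳ (atNode v a p q) (holds⇒visits W rest)

    arcs-use : ∀ {v a} (W : WalkS k r d v a) {p q p' q'} → arcs W p q p' q' ≡ true → ArcUse k p q p'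
    arcs-use (move {v} {a} {w} {b} _ u W) {p} {q} {p'} {q'} used with ∨-true (arcAt v a w b p q p' q') used
    ... | inj₂ rest = arcs-use W rest
    ... | inj₁ first with atNode-true {v} {a} {p} {q} (proj₁ (∧-true first)) | atNode-true {w} {b} {p'} {q'} (proj₂ (∧-true {atNode v a p q} first))
    ...   | refl , refl | refl , refl = u
    arcs-use (hold _ _ W) used = arcs-use W used

    holds-use : ∀ {v a} (W : WalkS k r d v a) {p q} → holds W p q ≡ true → HoldUse k p q × isHold I S p q ≡ true
    holds-use (move _ _ W) used = holds-use W used
    holds-use (hold {v} {a} hd u W) {p} {q} used with ∨-true (atNode v a p q) used
    ... | inj₂ rest = holds-use W rest
    ... | inj₁ first with atNode-true {v} {a} {p} {q} first
    ...   | refl , refl = u , hd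

    shortcut : ∀ {v a} (W : WalkS k r d v a) {p q} → visits W p q ≡ true → Simple W → Σ (WalkS k r d p q) Simple
    shortcut {v} {a} [] {p} {q} vis _ with atNode-true {v} {a} {p} {q} vis
    ... | refl , refl = [] , tt
    shortcut {v} {a} W@(move _ _ W') {p} {q} vis simple with toSum ((p ≟ v) ×-dec (q ≟ℕ a))
    ... | inj₁ (refl , refl) = W , simple
    ... | inj₂ ne = shortcut W' (∨-resolveˡ (atNode-other v a p q ne) vis) (proj₂ simple)
    shortcut {v} {a} W@(hold _ _ W') {p} {q} vis simple with toSum ((p ≟ v) ×-dec (q ≟ℕ a))
    ... | inj₁ (refl , refl) = W , simple
    ... | inj₂ ne = shortcut W' (∨-resolveˡ (atNode-other v a p q ne) vis) (proj₂ simple)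

    simplify : ∀ {v a} → WalkS k r d v a → Σ (WalkS k r d v a) Simple
    simplify [] = [] , tt
    simplify {v} {a} (move e u W) with simplify W
    ... | W' , simple with visits W' v a in revisit
    ...   | true  = shortcut W' revisit simple
    ...   | false = move e u W' , revisit , simple
    simplify {v} {a} (hold hd u W) with simplify W
    ... | W' , simple with visits W' v a in revisit
    ...   | true  = shortcut W' revisit simple
    ...   | false = hold hd u W' , revisit , simple

    fresh : ∀ {v a v' a'} (W : WalkS k r d v' a') {p q} → visits W v a ≡ false → atNode v a p q ≡ true → visits W p q ≡ false
    fresh W {p} {q} nv at with atNode-true {_} {_} {p} {q} at
    ... | refl , refl = nv

  private
    disjoint-split : ∀ {a b : Bool} (A B : ℕ) → (a ≡ true → b ≡ false) → A ≡ bit a → B ≡ bit b → A + B ≡ bit (a ∨ b)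
    disjoint-split {a} {b} A B disj A≡ B≡ = trans (cong₂ _+_ A≡ B≡) (sym (bit-∨ a b disj))

    out-rearrange : ∀ x y z w → ((x + y) + z) + w ≡ x + ((y + z) + w)
    out-rearrange = solve-∀

    out-rearrange′ : ∀ x y z w → (x + (y + z)) + w ≡ y + ((x + z) + w)
    out-rearrange′ = solve-∀

    in-rearrange : ∀ x y z w → ((x + y) + z) + w ≡ ((y + z) + x) + w
    in-rearrange = solve-∀

    in-rearrange′ : ∀ x y z w → (x + (y + z)) + w ≡ ((x + z) + y) + w
    in-rearrange′ = solve-∀

  outArcs-∨ : ∀ (Y Y' : ArcsS) p q → (∀ w b → Y p q w b ≡ true → Y' p q w b ≡ false) →
              outArcs (λ p q w b → Y p q w b ∨ Y' p q w b) p q ≡ outArcs Y p q + outArcs Y' p q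
  outArcs-∨ Y Y' p q disj =
    trans (∑-cong (allFin n) (λ w → ∑[]·bit-∨ (upTo (suc T)) (inAS p q w) (Y p q w) (Y' p q w) (disj w))) (∑-+ (allFin n) _ _)

  inArcs-∨ : ∀ (Y Y' : ArcsS) p q → (∀ w a → Y w a p q ≡ true → Y' w a p q ≡ false) →
             inArcs (λ p q w b → Y p q w b ∨ Y' p q w b) p q ≡ inArcs Y p q + inArcs Y' p q
  inArcs-∨ Y Y' p q disj =
    trans (∑-cong (allFin n) (λ w → ∑[]·bit-∨ (upTo (suc T)) (λ a → inAS w a p q) (λ a → Y w a p q) (λ a → Y' w a p q) (disj w)))
          (∑-+ (allFin n) _ _)

  outHolds-∨ : ∀ (G G' : HoldsS) p q → (G p q ≡ true → G' p q ≡ false) →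
               outHolds (λ p q → G p q ∨ G' p q) p q ≡ outHolds G p q + outHolds G' p q
  outHolds-∨ G G' p q disj = trans (cong ([ isHold I S p q ]·_) (bit-∨ (G p q) (G' p q) disj)) ([]·-+ (isHold I S p q) _ _)

  inHolds-∨ : ∀ (G G' : HoldsS) p q → (∀ c → G p c ≡ true → G' p c ≡ false) →
              inHolds (λ p q → G p q ∨ G' p q) p q ≡ inHolds G p q + inHolds G' p q
  inHolds-∨ G G' p q disj = ∑[]·bit-∨ (upTo (suc T)) (λ c → isHold I S p c ∧ (nS I S p c ≡ᵇ q)) (G p) (G' p) disj

  module _ {k : Fin K} {r : Fin n} {d : ℕ} where

    out-walk : ∀ {v a} (W : WalkS k r d v a) → Simple W → ∀ p q →
               (outArcs (arcs W) p q + outHolds (holds W) p q) + point r d p q ≡ bit (visits W p q)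
    out-walk [] _ p q =
      trans (cong₂ (λ A H → (A + H) + point r d p q) (∑-zero (allFin n) (λ _ → ∑-zero (upTo (suc T)) (λ _ → []·-zero _))) ([]·-zero _))
            ([]·1≡bit _)
    out-walk {v} {a} (move {w = w} {b} ∈A u W) (nv , simple) p q = begin
      (outArcs (arcs (move ∈A u W)) p q + H) + E
        ≡⟨ cong (λ A → (A + H) + E) (outArcs-∨ (arcAt v a w b) (arcs W) p q disj) ⟩
      ((outArcs (arcAt v a w b) p q + outArcs (arcs W) p q) + H) + E
        ≡⟨ out-rearrange (outArcs (arcAt v a w b) p q) (outArcs (arcs W) p q) H E ⟩
      outArcs (arcAt v a w b) p q + ((outArcs (arcs W) p q + H) + E)
        ≡⟨ disjoint-split _ _ (fresh W nv) (outArcs-arcAt ∈A b≤T p q) (out-walk W simple p q) ⟩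
      bit (visits (move ∈A u W) p q) ∎
      where
      open ≡-Reasoning
      H = outHolds (holds W) p q
      E = point r d p q
      b≤T = NS⊆NT w b (proj₁ (proj₂ (AS-ends v a w b ∈A)))
      disj : ∀ w' b' → arcAt v a w b p q w' b' ≡ true → arcs W p q w' b' ≡ false
      disj w' b' first with atNode-true {v} {a} {p} {q} (proj₁ (∧-true first))
      ... | refl , refl = false-if-not-true (λ used → clash (arcs⇒visits W used) nv)
    out-walk {v} {a} (hold hd u W) (nv , simple) p q = begin
      (A + outHolds (holds (hold hd u W)) p q) + E
        ≡⟨ cong (λ H → (A + H) + E) (outHolds-∨ (atNode v a) (holds W) p q disj) ⟩
      (A + (outHolds (atNode v a) p q + outHolds (holds W) p q)) + E
        ≡⟨ out-rearrange′ A (outHolds (atNode v a) p q) (outHolds (holds W) p q) E ⟩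
      outHolds (atNode v a) p q + ((A + outHolds (holds W) p q) + E)
        ≡⟨ disjoint-split _ _ (fresh W nv) (outHolds-atNode hd p q) (out-walk W simple p q) ⟩
      bit (visits (hold hd u W) p q) ∎
      where
      open ≡-Reasoning
      A = outArcs (arcs W) p q
      E = point r d p q
      disj : atNode v a p q ≡ true → holds W p q ≡ false
      disj first = false-if-not-true (λ used → clash (holds⇒visits W used) (fresh W nv first))

    in-walk : ∀ {v a} (W : WalkS k r d v a) → Simple W → ∀ p q →
              (inArcs (arcs W) p q + inHolds (holds W) p q) + point v a p q ≡ bit (visits W p q)
    in-walk [] _ p q = trans (cong₂ (λ A H → (A + H) + point r d p q) (∑-zero (allFin n) (λ _ → ∑-zero (upTo (suc T)) (λ _ → []·-zero _)))
                                                                       (∑-zero (upTo (suc T)) (λ _ → []·-zero _)))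
                             ([]·1≡bit _)
    in-walk {v} {a} (move {w = w} {b} ∈A u W) (nv , simple) p q = begin
      (inArcs (arcs (move ∈A u W)) p q + H) + E
        ≡⟨ cong (λ A → (A + H) + E) (inArcs-∨ (arcAt v a w b) (arcs W) p q disj) ⟩
      ((inArcs (arcAt v a w b) p q + inArcs (arcs W) p q) + H) + E
        ≡⟨ in-rearrange (inArcs (arcAt v a w b) p q) (inArcs (arcs W) p q) H E ⟩
      ((inArcs (arcs W) p q + H) + inArcs (arcAt v a w b) p q) + E
        ≡⟨ cong (λ X → ((inArcs (arcs W) p q + H) + X) + E) (trans (inArcs-arcAt ∈A a≤T p q) (sym ([]·1≡bit _))) ⟩
      ((inArcs (arcs W) p q + H) + point w b p q) + E
        ≡⟨ +-comm _ E ⟩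
      E + ((inArcs (arcs W) p q + H) + point w b p q)
        ≡⟨ disjoint-split _ _ (fresh W nv) ([]·1≡bit _) (in-walk W simple p q) ⟩
      bit (visits (move ∈A u W) p q) ∎
      where
      open ≡-Reasoning
      H = inHolds (holds W) p q
      E = point v a p q
      a≤T = NS⊆NT v a (proj₁ (AS-ends v a w b ∈A))
      disj : ∀ w' a' → arcAt v a w b w' a' p q ≡ true → arcs W w' a' p q ≡ false
      disj w' a' first with atNode-true {v} {a} {w'} {a'} (proj₁ (∧-true first))
      ... | refl , refl = false-if-not-true (λ used → clash (arcs⇒visits W used) nv)
    in-walk {v} {a} (hold hd u W) (nv , simple) p q = begin
      (A + inHolds (holds (hold hd u W)) p q) + E
        ≡⟨ cong (λ H → (A + H) + E) (inHolds-∨ (atNode v a) (holds W) p q disj) ⟩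
      (A + (inHolds (atNode v a) p q + inHolds (holds W) p q)) + E
        ≡⟨ in-rearrange′ A (inHolds (atNode v a) p q) (inHolds (holds W) p q) E ⟩
      ((A + inHolds (holds W) p q) + inHolds (atNode v a) p q) + E
        ≡⟨ cong (λ X → ((A + inHolds (holds W) p q) + X) + E) (trans (inHolds-atNode hd p q) (sym ([]·1≡bit _))) ⟩
      ((A + inHolds (holds W) p q) + point v (nS I S v a) p q) + E
        ≡⟨ +-comm _ E ⟩
      E + ((A + inHolds (holds W) p q) + point v (nS I S v a) p q)
        ≡⟨ disjoint-split _ _ (fresh W nv) ([]·1≡bit _) (in-walk W simple p q) ⟩
      bit (visits (hold hd u W) p q) ∎
      where
      open ≡-Reasoning
      A = inArcs (arcs W) p q
      E = point v a p q
      disj : ∀ c → atNode v a p c ≡ true → holds W p c ≡ false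
      disj c first = false-if-not-true (λ used → clash (holds⇒visits W used) (fresh W nv first))

-- The solution of UPR(D_S)

module Solution (I : Instance) (S : PTEN I) (V : Valid I S)
                (x : MoveVarsT I) (h : HoldVarsT I) (Tbar : ℕ) (F : FeasibleT I x h Tbar) where
  open Instance I
  open PTEN S
  open Valid V
  open Decomposition I
  open Simulation I S V x h
  open WalkFlow I S V x h
  open FeasibleT F

  -- conservation k unfolds to IsFlow (x k) (h k) (src k) 0 (dst k) T.
  route : ∀ k → Σ (WalkS k (dst k) T (src k) 0) Simple
  route k = simplify (simulate (walk-of-flow z≤n (conservation k)) start)
    where
    start : Tracking k (src k) 0 0 0
    start = record { inS-a = P1-src k ; a≤x₀ = z≤n ; x₀≤t = z≤n ; t≤T = z≤n
                   ; held = λ j 0≤j j<0 → contradiction j<0 (λ ()) ; arrival = origin }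

  y : MoveVarsS I S
  y k = arcs (proj₁ (route k))

  g : HoldVarsS I S
  g k = holds (proj₁ (route k))

  y-use : ∀ {k v a w b} → y k v a w b ≡ true → ArcUse k v a w
  y-use {k} = arcs-use (proj₁ (route k))

  conservationS : ∀ k v t → inS v t ≡ true → outS I S y g k v t + demand I k v t ≡ inS' I S y g k v t + supply I k v t
  conservationS k v t _ = trans (out-walk (proj₁ (route k)) (proj₂ (route k)) v t) (sym (in-walk (proj₁ (route k)) (proj₂ (route k)) v t))

  arrivalS : ∀ k v t w t' → inAS v t w t' ≡ true → (t + τ v w) * bit (y k v t w t') ≤ Tbar
  arrivalS k v t w t' _ with y k v t w t' in used
  ... | false = subst (_≤ Tbar) (sym (*-zeroʳ (t + τ v w))) z≤n
  ... | true with y-use used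
  ...   | departs-at s t≤s _ mv xs =
    ≤-trans (*-monoˡ-≤ 1 (+-monoˡ-≤ (τ v w) t≤s))
            (subst (λ b → (s + τ v w) * bit b ≤ Tbar) xs (arrival k v w s (isMoveT-arc {t = s} mv) (isMoveT-≤T {t = s} mv)))

  inWindow : ℕ → ℕ → Fin n → Fin n → ℕ → Bool
  inWindow lo hi v w s = (lo ≤ᵇ s) ∧ (s <ᵇ hi) ∧ isMoveT I v w s

  movesIn : Fin K → Fin n → Fin n → ℕ → ℕ → ℕ
  movesIn k v w lo hi = ∑ (upTo (suc T)) (λ s → [ inWindow lo hi v w s ]· bit (x k v w s))

  move-counted : ∀ {k v w lo hi s} → lo ≤ s → s < hi → isMoveT I v w s ≡ true → x k v w s ≡ true → 1 ≤ movesIn k v w lo hi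
  move-counted {k} {v} {w} {lo} {hi} {s} lo≤s s<hi mv xs =
    subst (_≤ movesIn k v w lo hi) counted (term≤∑ (λ s → [ inWindow lo hi v w s ]· bit (x k v w s)) (∈-upTo⁺ (s≤s s≤T)))
    where
    s≤T = ≤-trans (m≤m+n s (τ v w)) (isMoveT-≤T {t = s} mv)
    counted : [ inWindow lo hi v w s ]· bit (x k v w s) ≡ 1
    counted rewrite dec-true (lo ≤? s) lo≤s | dec-true (s <? hi) s<hi | mv | xs = refl

  window-capacity : ∀ v w lo hi → ∑ (allFin K) (λ k → movesIn k v w lo hi) ≤ u v w * (hi ∸ lo)
  window-capacity v w lo hi = begin
    ∑ (allFin K) (λ k → movesIn k v w lo hi)
      ≡⟨ ∑-comm (allFin K) (upTo (suc T)) (λ k s → [ inWindow lo hi v w s ]· bit (x k v w s)) ⟩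
    ∑ (upTo (suc T)) (λ s → ∑ (allFin K) (λ k → [ inWindow lo hi v w s ]· bit (x k v w s)))
      ≡⟨ ∑-cong (upTo (suc T)) (λ s → ∑-[]· (allFin K) (inWindow lo hi v w s) (λ k → bit (x k v w s))) ⟩
    ∑ (upTo (suc T)) (λ s → [ inWindow lo hi v w s ]· ∑ (allFin K) (λ k → bit (x k v w s)))
      ≤⟨ ∑-mono (upTo (suc T)) within-capacity ⟩
    ∑ (upTo (suc T)) (λ s → [ inWindow lo hi v w s ]· u v w)
      ≤⟨ ∑-interval (suc T) _ (u v w) lo hi (λ s → []·-≤ (inWindow lo hi v w s) (u v w)) support ⟩
    u v w * (hi ∸ lo) ∎
    where
    open ≤-Reasoning
    within-capacity : ∀ s → [ inWindow lo hi v w s ]· ∑ (allFin K) (λ k → bit (x k v w s)) ≤ [ inWindow lo hi v w s ]· u v w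
    within-capacity s with inWindow lo hi v w s in win
    ... | false = z≤n
    ... | true  = capacity v w s (isMoveT-arc {t = s} mv) (isMoveT-≤T {t = s} mv)
      where mv = proj₂ (∧-true {s <ᵇ hi} (proj₂ (∧-true {lo ≤ᵇ s} win)))
    support : ∀ s → 0 < [ inWindow lo hi v w s ]· u v w → lo ≤ s × s < hi
    support s pos with ∧-true ([]·-pos (inWindow lo hi v w s) (u v w) pos)
    ... | lo≤s , rest = from-does (lo ≤? s) lo≤s , from-does (s <? hi) (proj₁ (∧-true rest))

  capacityS : ∀ v t w t' → inAS v t w t' ≡ true → ΣFin K (λ k → bit (y k v t w t')) ≤ u' v t w t'
  capacityS v t w t' ∈A = begin
    ∑ (allFin K) (λ k → bit (y k v t w t'))  ≤⟨ ∑-mono (allFin K) used-in-window ⟩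
    ∑ (allFin K) (λ k → movesIn k v w t (nS I S v t)) ≤⟨ window-capacity v w t (nS I S v t) ⟩
    u v w * mS I S v t                       ≡⟨ sym (Parcs v t w t' ∈A) ⟩
    u' v t w t'                              ∎
    where
    open ≤-Reasoning
    used-in-window : ∀ k → bit (y k v t w t') ≤ movesIn k v w t (nS I S v t)
    used-in-window k with y k v t w t' in used
    ... | false = z≤n
    ... | true with y-use used
    ...   | departs-at s t≤s s<nS mv xs = move-counted t≤s s<nS mv xs

  heldAt : Fin K → Fin n → ℕ → ℕ
  heldAt k v c = [ inKv I v k ]· bit (h k v c)

  heldBefore : Fin K → Fin n → ℕ → ℕ
  heldBefore k v c = [ not (inS v (suc c)) ]· heldAt k v (nS I S v c ∸ 1)

  passingMoves : Fin K → Fin n → ℕ → ℕ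
  passingMoves k v c = ∑ (allFin n) (λ w → ∑ (upTo (suc T)) (λ t' → [ incoming w t' v c ]· movesIn k w v (suc t') (nS I S w t')))

  hold-charged : ∀ {k v c} → inKv I v k ≡ true → HoldUse k v c → 1 ≤ (heldAt k v c + heldBefore k v c) + passingMoves k v c
  hold-charged {k} {v} {c} kv (held-at he) rewrite kv | he = s≤s z≤n
  hold-charged {k} {v} {c} kv (held-before gap he) rewrite kv | gap | he =
    ≤-trans (m≤n+m 1 (bit (h k v c))) (m≤m+n _ (passingMoves k v c))
  hold-charged {k} {v} {c} kv (passing w t' s t'≤T inc t'<s s<nS mv xs) = begin
    1                                                    ≤⟨ move-counted t'<s s<nS mv xs ⟩
    movesIn k w v (suc t') (nS I S w t')                 ≡⟨ cong ([_]· movesIn k w v (suc t') (nS I S w t')) (sym inc) ⟩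
    [ incoming w t' v c ]· movesIn k w v (suc t') (nS I S w t')
      ≤⟨ term≤∑ (λ t' → [ incoming w t' v c ]· movesIn k w v (suc t') (nS I S w t')) (∈-upTo⁺ (s≤s t'≤T)) ⟩
    ∑ (upTo (suc T)) (λ t' → [ incoming w t' v c ]· movesIn k w v (suc t') (nS I S w t'))
      ≤⟨ term≤∑ (λ w → ∑ (upTo (suc T)) (λ t' → [ incoming w t' v c ]· movesIn k w v (suc t') (nS I S w t'))) (∈-allFin w) ⟩
    passingMoves k v c                                   ≤⟨ m≤n+m _ _ ⟩
    (heldAt k v c + heldBefore k v c) + passingMoves k v c ∎
    where open ≤-Reasoning

  held-bound : ∀ v c → c < T → ∑ (allFin K) (λ k → heldAt k v c) ≤ b v
  held-bound v c c<T = storage v c c<T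

  heldBefore-bound : ∀ v c → isHold I S v c ≡ true → ∑ (allFin K) (λ k → heldBefore k v c) ≤ [ not (inS v (suc c)) ]· b v
  heldBefore-bound v c hd =
    subst (_≤ [ not (inS v (suc c)) ]· b v) (sym (∑-[]· (allFin K) (not (inS v (suc c))) (λ k → heldAt k v (nS I S v c ∸ 1))))
          ([]·-mono (not (inS v (suc c))) (storage v (nS I S v c ∸ 1) (pred-< (<nS (<⇒≤ (isHold-< hd))) (isHold-nS≤T hd))))
    where
    pred-< : ∀ {m} → c < m → m ≤ T → m ∸ 1 < T
    pred-< {suc m} _ m≤T = m≤T

  passing-bound : ∀ v c → ∑ (allFin K) (λ k → passingMoves k v c) ≤ U I S v c
  passing-bound v c = begin
    ∑ (allFin K) (λ k → passingMoves k v c)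
      ≡⟨ ∑-comm (allFin K) (allFin n) _ ⟩
    ∑ (allFin n) (λ w → ∑ (allFin K) (λ k → ∑ (upTo (suc T)) (λ t' → [ incoming w t' v c ]· moves k w t')))
      ≡⟨ ∑-cong (allFin n) (λ w → trans (∑-comm (allFin K) (upTo (suc T)) _)
                                         (∑-cong (upTo (suc T)) (λ t' → ∑-[]· (allFin K) (incoming w t' v c) (λ k → moves k w t')))) ⟩
    ∑ (allFin n) (λ w → ∑ (upTo (suc T)) (λ t' → [ incoming w t' v c ]· ∑ (allFin K) (λ k → moves k w t')))
      ≤⟨ ∑-mono (allFin n) (λ w → ∑-mono (upTo (suc T)) (λ t' → []·-mono (incoming w t' v c) (window w t'))) ⟩
    U I S v c ∎
    where
    open ≤-Reasoning
    moves : Fin K → Fin n → ℕ → ℕ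
    moves k w t' = movesIn k w v (suc t') (nS I S w t')
    window : ∀ w t' → ∑ (allFin K) (λ k → moves k w t') ≤ u w v * (mS I S w t' ∸ 1)
    window w t' = subst (∑ (allFin K) (λ k → moves k w t') ≤_)
                        (cong (u w v *_) (sym (trans (∸-+-assoc (nS I S w t') t' 1) (cong (nS I S w t' ∸_) (+-comm t' 1)))))
                        (window-capacity w v (suc t') (nS I S w t'))

  storageS : ∀ v c → isHold I S v c ≡ true → ΣFin K (λ k → [ inKv I v k ]· bit (g k v c)) ≤ b' v c
  storageS v c hd = begin
    ∑ (allFin K) (λ k → [ inKv I v k ]· bit (g k v c))
      ≤⟨ ∑-mono (allFin K) charged ⟩
    ∑ (allFin K) (λ k → (heldAt k v c + heldBefore k v c) + passingMoves k v c)
      ≡⟨ trans (∑-+ (allFin K) _ _) (cong (_+ ∑ (allFin K) (λ k → passingMoves k v c)) (∑-+ (allFin K) _ _)) ⟩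
    (∑ (allFin K) (λ k → heldAt k v c) + ∑ (allFin K) (λ k → heldBefore k v c)) + ∑ (allFin K) (λ k → passingMoves k v c)
      ≤⟨ +-mono-≤ (+-mono-≤ (held-bound v c (isHold-< hd)) (heldBefore-bound v c hd)) (passing-bound v c) ⟩
    (b v + [ not (inS v (suc c)) ]· b v) + U I S v c
      ≤⟨ Pstorage ⟩
    b' v c ∎
    where
    open ≤-Reasoning
    charged : ∀ k → [ inKv I v k ]· bit (g k v c) ≤ (heldAt k v c + heldBefore k v c) + passingMoves k v c
    charged k with g k v c in used
    ... | false = ≤-trans (≤-reflexive ([]·-zero _)) z≤n
    ... | true  = []·-≤-from (inKv I v k) (λ kv → hold-charged kv (proj₁ (holds-use (proj₁ (route k)) used)))
    Pstorage : (b v + [ not (inS v (suc c)) ]· b v) + U I S v c ≤ b' v c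
    Pstorage with inS v (suc c) in next
    ... | true  = subst (λ m → m + U I S v c ≤ b' v c) (sym (+-identityʳ (b v))) (Pstorage-next v c hd next)
    ... | false = subst (λ m → m + U I S v c ≤ b' v c) (cong (b v +_) (+-identityʳ (b v))) (Pstorage-gap v c hd next)

  departures≤1 : ∀ k v a w → ∑ (upTo (suc T)) (λ b → [ inAS v a w b ]· bit (y k v a w b)) ≤ 1
  departures≤1 k v a w = begin
    ∑ (upTo (suc T)) (λ b → [ inAS v a w b ]· bit (y k v a w b))
      ≤⟨ term≤∑ (λ w → ∑ (upTo (suc T)) (λ b → [ inAS v a w b ]· bit (y k v a w b))) (∈-allFin w) ⟩
    outArcs (y k) v a                                          ≤⟨ m≤m+n _ _ ⟩
    outArcs (y k) v a + outHolds (g k) v a                     ≤⟨ m≤m+n _ _ ⟩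
    (outArcs (y k) v a + outHolds (g k) v a) + point (dst k) T v a ≡⟨ out-walk (proj₁ (route k)) (proj₂ (route k)) v a ⟩
    bit (visits (proj₁ (route k)) v a)                         ≤⟨ bit≤1 _ ⟩
    1 ∎
    where open ≤-Reasoning

  module _ (k : Fin K) where

    arrivalCost : Fin n → ℕ → ℕ
    arrivalCost v s = [ isMoveT I v (dst k) s ]· ((s + τ v (dst k)) * bit (x k v (dst k) s))

    owns : Fin n → ℕ → ℕ → Bool
    owns v a s = inS v a ∧ (a ≤ᵇ s) ∧ (s <ᵇ nS I S v a)

    arrival-charged : ∀ v a → ∑ (upTo (suc T)) (λ b → [ inAS v a (dst k) b ]· ((a + τ v (dst k)) * bit (y k v a (dst k) b)))
                             ≤ ∑ (upTo (suc T)) (λ s → [ owns v a s ]· arrivalCost v s)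
    arrival-charged v a =
      subst (_≤ ∑ (upTo (suc T)) (λ s → [ owns v a s ]· arrivalCost v s)) (sym factored) (charge (departures≤1 k v a d))
      where
      d = dst k
      departures : ℕ
      departures = ∑ (upTo (suc T)) (λ b → [ inAS v a d b ]· bit (y k v a d b))
      factored : ∑ (upTo (suc T)) (λ b → [ inAS v a d b ]· ((a + τ v d) * bit (y k v a d b))) ≡ (a + τ v d) * departures
      factored = trans (∑-cong (upTo (suc T)) (λ b → []·-* (inAS v a d b) (a + τ v d) (bit (y k v a d b))))
                       (∑-*ˡ (upTo (suc T)) (a + τ v d) _)
      charge : departures ≤ 1 → (a + τ v d) * departures ≤ ∑ (upTo (suc T)) (λ s → [ owns v a s ]· arrivalCost v s)
      charge ≤1 with departures in count
      ... | zero  = subst (_≤ ∑ (upTo (suc T)) (λ s → [ owns v a s ]· arrivalCost v s)) (sym (*-zeroʳ (a + τ v d))) z≤n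
      ... | suc m with ∑-pos (upTo (suc T)) (λ b → [ inAS v a d b ]· bit (y k v a d b)) (subst (0 <_) (sym count) z<s)
      ...   | b , _ , pos with []·bit-pos (inAS v a d b) (y k v a d b) pos
      ...     | ∈A , used with y-use used
      ...       | departs-at s a≤s s<nS mv xs = begin
        (a + τ v d) * suc m      ≡⟨ cong (λ m → (a + τ v d) * suc m) (n≤0⇒n≡0 (s≤s⁻¹ ≤1)) ⟩
        (a + τ v d) * 1          ≤⟨ *-monoˡ-≤ 1 (+-monoˡ-≤ (τ v d) a≤s) ⟩
        (s + τ v d) * 1          ≡⟨ sym owned ⟩
        [ owns v a s ]· arrivalCost v s
          ≤⟨ term≤∑ (λ s → [ owns v a s ]· arrivalCost v s) (∈-upTo⁺ (s≤s (≤-trans (m≤m+n s (τ v d)) (isMoveT-≤T {t = s} mv)))) ⟩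
        ∑ (upTo (suc T)) (λ s → [ owns v a s ]· arrivalCost v s) ∎
        where
        open ≤-Reasoning
        owned : [ owns v a s ]· arrivalCost v s ≡ (s + τ v d) * 1
        owned rewrite proj₁ (AS-ends v a d b ∈A) | dec-true (a ≤? s) a≤s | dec-true (s <? nS I S v a) s<nS | mv | xs = refl

    owns-inS : ∀ {v a s} → owns v a s ≡ true → inS v a ≡ true
    owns-inS {v} {a} own = proj₁ (∧-true {inS v a} own)

    owns-≤ : ∀ {v a s} → owns v a s ≡ true → a ≤ s
    owns-≤ {v} {a} {s} own = from-does (a ≤? s) (proj₁ (∧-true {a ≤ᵇ s} (proj₂ (∧-true {inS v a} own))))

    owns-< : ∀ {v a s} → owns v a s ≡ true → s < nS I S v a
    owns-< {v} {a} {s} own = from-does (s <? nS I S v a) (proj₂ (∧-true {a ≤ᵇ s} (proj₂ (∧-true {inS v a} own))))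

    owner-unique : ∀ v s a a' → owns v a s ≡ true → owns v a' s ≡ true → a ≡ a'
    owner-unique v s a a' own own' with <-cmp a a'
    ... | tri≈ _ a≡a' _ = a≡a'
    ... | tri< a<a' _ _ = contradiction (nS-gap (NS⊆NT v a (owns-inS own)) a<a' (≤-<-trans (owns-≤ own') (owns-< own))) (clash (owns-inS own'))
    ... | tri> _ _ a'<a = contradiction (nS-gap (NS⊆NT v a' (owns-inS own')) a'<a (≤-<-trans (owns-≤ own) (owns-< own'))) (clash (owns-inS own))

  arrivalSumS : ∀ k → ΣFin n (λ v → Σ≤ T (λ t → Σ≤ T (λ t' →
                  [ inAS v t (dst k) t' ]· ((t + τ v (dst k)) * bit (y k v t (dst k) t'))))) ≤ Tbar
  arrivalSumS k = begin
    ∑ (allFin n) (λ v → ∑ (upTo (suc T)) (λ a → ∑ (upTo (suc T)) (λ b → [ inAS v a (dst k) b ]· ((a + τ v (dst k)) * bit (y k v a (dst k) b)))))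
      ≤⟨ ∑-mono (allFin n) (λ v → ∑-mono (upTo (suc T)) (arrival-charged k v)) ⟩
    ∑ (allFin n) (λ v → ∑ (upTo (suc T)) (λ a → ∑ (upTo (suc T)) (λ s → [ owns k v a s ]· arrivalCost k v s)))
      ≡⟨ ∑-cong (allFin n) (λ v → ∑-comm (upTo (suc T)) (upTo (suc T)) _) ⟩
    ∑ (allFin n) (λ v → ∑ (upTo (suc T)) (λ s → ∑ (upTo (suc T)) (λ a → [ owns k v a s ]· arrivalCost k v s)))
      ≤⟨ ∑-mono (allFin n) (λ v → ∑-mono (upTo (suc T)) (λ s →
           ∑-atMostOne _ (arrivalCost k v s) (upTo⁺ (suc T)) (λ a → []·-≤ (owns k v a s) _)
                       (λ a a' p p' → owner-unique k v s a a' ([]·-pos _ _ p) ([]·-pos _ _ p')))) ⟩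
    ∑ (allFin n) (λ v → ∑ (upTo (suc T)) (arrivalCost k v))
      ≤⟨ arrivalSum k ⟩
    Tbar ∎
    where open ≤-Reasoning

  feasibleS : FeasibleS I S y g Tbar
  feasibleS = record { arrival = arrivalS ; arrivalSum = arrivalSumS ; conservation = conservationS ; capacity = capacityS ; storage = storageS }

theorem1 : (I : Instance) (S : PTEN I) → Valid I S →
           (x : MoveVarsT I) (h : HoldVarsT I) (Tbar : ℕ) → FeasibleT I x h Tbar →
           Σ (MoveVarsS I S) (λ y → Σ (HoldVarsS I S) (λ g → Σ ℕ (λ Tbar' →
             FeasibleS I S y g Tbar' × Tbar' ≤ Tbar)))
theorem1 I S V x h Tbar F = y , g , Tbar , feasibleS , ≤-refl
  where open Solution I S V x h Tbar F
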